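{- Let $m$ be a positive integer. Then for every positive integer $n>\dfrac{14.4}{\left(\sqrt[m]{1.5}-1\right)^m}$ there exist a positive integer $a$ and a prime number $s$ such that $n<a^m<\frac{3n}{2}<s<2n$.
   Context: $\sqrt[m]{x}$ denotes the positive real $m$-th root of a positive real number $x$. All inequalities are strict. -}

module Defs where

open import Data.Nat using (ℕ; _+_; _*_; _^_; _<_)
open import Data.Product using (∃-syntax; _×_)

-- AboveThreshold m n  encodes the real inequality
--     n > 14.4 / ( (1.5)^(1/m) - 1 )^m
-- (with the positive real m-th root).  Since ℝ is unavailable, it is
-- expressed via a rational witness t = p / q > 0 with
--     (1 + t)^m < 3/2      (i.e.  t < 1.5^(1/m) - 1)
--     n * t^m  > 72/5      (i.e.  n * t^m > 14.4)
-- which, by density of ℚ and monotonicity of x ↦ x^m on positives,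
-- is equivalent to the real inequality.  Cleared of denominators:
AboveThreshold : ℕ → ℕ → Set
AboveThreshold m n =
  ∃[ p ] ∃[ q ] (0 < p) × (0 < q)
    × (2 * (q + p) ^ m < 3 * q ^ m)
    × (72 * q ^ m < 5 * n * p ^ m)

-- Write the rational witness of AboveThreshold as t = p / q, so that (1 + t)^m < 3/2 and n t^m > 72/5.
-- For b = ⌊n^(1/m)⌋ and a = b + 1 we have n < a^m, and a < n^(1/m) + (n t^m)^(1/m) = n^(1/m) (1 + t) gives
-- a^m < 3n/2; cleared of denominators, this step is Minkowski's inequality for m-th roots.  Moreover
-- (1 + t)^m < 3/2 forces t < 1/2, so n > 72 / (5 t^m) ≥ 28.8.
--
-- The prime is a Bertrand-type prime in (3n/2, 2n), which exists for every n ≥ 29: a table of primes covers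
-- n < 2761, and Chebyshev's method the rest.  The quotient F(x) = x! ⌊x/30⌋! / (⌊x/2⌋! ⌊x/3⌋! ⌊x/5⌋!) is an
-- integer whose p-adic valuation is Σₖ ν(⌊x/pᵏ⌋) for a weight ν with values in {0, 1}; hence F(x) divides
-- lcm(1, …, x), and binomial estimates give 2^(39t) ≤ poly(t) F(30t) and F(30t) ≤ poly(t) 2^(40t).  If there
-- were no prime in (3n/2, 2n), every prime power dividing lcm(1, …, 2n) would divide
-- lcm(1, …, 3n/2) · lcm(1, …, √(2n)), and comparing sizes gives a contradiction.

module Submission where

import Algebra.Definitions.RawMonoid as RawMonoid
import Algebra.Definitions.RawSemiring as RawSemiring
import Algebra.Properties.CommutativeSemiring.Binomial as Binomial
open import Algebra.Bundles using (CommutativeSemiring)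
open import Data.Empty using (⊥-elim)
open import Data.Fin.Base using (Fin; zero; suc; toℕ; fromℕ<)
open import Data.Fin.Properties using (toℕ<n; toℕ-fromℕ<)
open import Data.List.Base using (List; []; _∷_)
open import Data.List.Relation.Unary.All using (All; []; _∷_; all?; lookupAny)
open import Data.List.Relation.Unary.Any as Any using (Any; any?)
open import Data.Nat
open import Data.Nat.Combinatorics using (_C_; nCk≡n!/k![n-k]!; k![n∸k]!∣n!)
open import Data.Nat.DivMod
open import Data.Nat.Divisibility
open import Data.Nat.Induction using (<-rec)
open import Data.Nat.ListAction using (product)
open import Data.Nat.Primality
open import Data.Nat.Primality.Factorisation using (PrimeFactorisation; factorise)
open import Data.Nat.Properties
open import Data.Nat.Tactic.RingSolver using (solve-∀)
open import Data.Product using (∃-syntax; _×_; _,_; proj₁; proj₂)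
open import Data.Sum using (_⊎_; inj₁; inj₂; [_,_]′)
open import Function using (_∘_; id)
open import Relation.Binary.PropositionalEquality
open import Relation.Nullary using (¬_; Dec; yes; no; _×-dec_; _→-dec_)
open import Relation.Nullary.Decidable using (from-yes)

open import Defs

^-distribʳ-* : ∀ m n o → (m * n) ^ o ≡ m ^ o * n ^ o
^-distribʳ-* m n zero    = refl
^-distribʳ-* m n (suc o) = trans (cong (m * n *_) (^-distribʳ-* m n o)) (interchange m n (m ^ o) (n ^ o))
  where
  interchange : ∀ a b c d → a * b * (c * d) ≡ a * c * (b * d)
  interchange = solve-∀

^-comm : ∀ m n o → (m ^ n) ^ o ≡ (m ^ o) ^ n
^-comm m n o = trans (^-*-assoc m n o) (trans (cong (m ^_) (*-comm n o)) (sym (^-*-assoc m o n)))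

m*n≤o⇒m≤o/n : ∀ {m n o} .{{_ : NonZero n}} → m * n ≤ o → m ≤ o / n
m*n≤o⇒m≤o/n {m} {n} le = subst (_≤ _ / n) (m*n/n≡m m n) (/-monoˡ-≤ n le)

m≤o/n⇒m*n≤o : ∀ {m n o} .{{_ : NonZero n}} → m ≤ o / n → m * n ≤ o
m≤o/n⇒m*n≤o {m} {n} {o} le = ≤-trans (*-monoˡ-≤ n le) (m/n*n≤m o n)

m/n≢0 : ∀ {m n} .{{_ : NonZero m}} .{{_ : NonZero n}} → n ∣ m → NonZero (m / n)
m/n≢0 n∣m = >-nonZero (m≥n⇒m/n>0 (∣⇒≤ n∣m))

m<[m/n]*n+n : ∀ m n .{{_ : NonZero n}} → m < m / n * n + n
m<[m/n]*n+n m n = begin-strict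
  m                 ≡⟨ m≡m%n+[m/n]*n m n ⟩
  m % n + m / n * n <⟨ +-monoˡ-< (m / n * n) (m%n<n m n) ⟩
  n + m / n * n     ≡⟨ +-comm n (m / n * n) ⟩
  m / n * n + n     ∎
  where open ≤-Reasoning

/-unique : ∀ {m n q r} .{{_ : NonZero n}} → m ≡ q * n + r → r < n → m / n ≡ q
/-unique {m} {n} {q} {r} refl r<n = begin
  (q * n + r) / n  ≡⟨ cong (_/ n) (+-comm (q * n) r) ⟩
  (r + q * n) / n  ≡⟨ +-distrib-/-∣ʳ r (n∣m*n q) ⟩
  r / n + q * n / n ≡⟨ cong₂ _+_ (m<n⇒m/n≡0 r<n) (m*n/n≡m q n) ⟩
  q                ∎
  where open ≡-Reasoning

[1+m]/n≡m/n : ∀ m n .{{_ : NonZero n}} → ¬ n ∣ suc m → suc m / n ≡ m / n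
[1+m]/n≡m/n m n n∤1+m = /-unique (begin
  suc m                   ≡⟨ cong suc (m≡m%n+[m/n]*n m n) ⟩
  suc (m % n) + m / n * n ≡⟨ +-comm (suc (m % n)) _ ⟩
  m / n * n + suc (m % n) ∎) 1+m%n<n
  where
  open ≡-Reasoning
  1+m%n<n : suc (m % n) < n
  1+m%n<n with m≤n⇒m<n∨m≡n (m%n<n m n)
  ... | inj₁ lt = lt
  ... | inj₂ eq = ⊥-elim (n∤1+m (divides (suc (m / n)) (begin
    suc m                   ≡⟨ cong suc (m≡m%n+[m/n]*n m n) ⟩
    suc (m % n) + m / n * n ≡⟨ cong (_+ m / n * n) eq ⟩
    suc (m / n) * n         ∎)))

[1+m]/n≡1+m/n : ∀ m n .{{_ : NonZero n}} → n ∣ suc m → suc m / n ≡ suc (m / n)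
[1+m]/n≡1+m/n m n n∣1+m = /-unique (begin
  suc m                   ≡⟨ cong suc (m≡m%n+[m/n]*n m n) ⟩
  suc (m % n) + m / n * n ≡⟨ cong (λ r → suc r + m / n * n) (%-pred-≡0 (n∣m⇒m%n≡0 (suc m) n n∣1+m)) ⟩
  suc (n ∸ 1) + m / n * n ≡⟨ cong (_+ m / n * n) (suc-pred n) ⟩
  suc (m / n) * n         ≡⟨ +-identityʳ _ ⟨
  suc (m / n) * n + 0     ∎) (>-nonZero⁻¹ n)
  where open ≡-Reasoning

[r+q*n]/d≡r/d+q*k : ∀ r q {n d k} .{{_ : NonZero d}} → k * d ≡ n → (r + q * n) / d ≡ r / d + q * k
[r+q*n]/d≡r/d+q*k r q {n} {d} {k} k*d≡n = begin
  (r + q * n) / d       ≡⟨ +-distrib-/-∣ʳ r (divides (q * k) q*n≡q*k*d) ⟩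
  r / d + q * n / d     ≡⟨ cong (λ y → r / d + y / d) q*n≡q*k*d ⟩
  r / d + q * k * d / d ≡⟨ cong (r / d +_) (m*n/n≡m (q * k) d) ⟩
  r / d + q * k         ∎
  where
  open ≡-Reasoning
  q*n≡q*k*d : q * n ≡ q * k * d
  q*n≡q*k*d = trans (cong (q *_) (sym k*d≡n)) (sym (*-assoc q k d))

module _ (b : ℕ) .{{_ : NonTrivial b}} where
  private instance
    b≢0 : NonZero b
    b≢0 = nonTrivial⇒nonZero b

  /-induction : (P : ℕ → Set) → P 0 → (∀ x → .{{_ : NonZero x}} → P (x / b) → P x) → ∀ x → P x
  /-induction P base step = <-rec P λ where
    zero      _   → base
    x@(suc _) rec → step x (rec (m/n<m x b (nonTrivial⇒n>1 b)))

  /-induction⁺ : (P : ℕ → Set) → (∀ x → .{{_ : NonZero x}} → (.{{_ : NonZero (x / b)}} → P (x / b)) → P x) →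
                 ∀ x → .{{_ : NonZero x}} → P x
  /-induction⁺ P step = /-induction (λ x → .{{_ : NonZero x}} → P x)
    (λ {{0≢0}} → ⊥-elim (≢-nonZero⁻¹ 0 {{0≢0}} refl)) (λ x ih → step x ih)

-- p-adic valuations

module _ {p : ℕ} (p-prime : Prime p) where
  private
    instance
      p-nonTrivial : NonTrivial p
      p-nonTrivial = prime⇒nonTrivial p-prime
      p≢0 : NonZero p
      p≢0 = prime⇒nonZero p-prime

    valuationWithin : ℕ → ℕ → ℕ
    valuationWithin _       zero      = 0
    valuationWithin zero    (suc _)   = 0
    valuationWithin (suc k) n@(suc _) with p ∣? n
    ... | yes _ = suc (valuationWithin k (n / p))
    ... | no  _ = 0

    valuationWithin-irrelevant : ∀ {k l} n → n ≤ k → n ≤ l → valuationWithin k n ≡ valuationWithin l n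
    valuationWithin-irrelevant zero _ _ = refl
    valuationWithin-irrelevant {suc k} {suc l} n@(suc _) n≤1+k n≤1+l with p ∣? n
    ... | yes _ = cong suc (valuationWithin-irrelevant (n / p) (shrink n≤1+k) (shrink n≤1+l))
      where
      shrink : ∀ {j} → n ≤ suc j → n / p ≤ j
      shrink n≤1+j = s≤s⁻¹ (≤-trans (m/n<m n p (nonTrivial⇒n>1 p)) n≤1+j)
    ... | no  _ = refl

  valuation : ℕ → ℕ
  valuation n = valuationWithin n n

  valuation-¬∣ : ∀ {n} → ¬ p ∣ n → valuation n ≡ 0
  valuation-¬∣ {zero}      p∤n = ⊥-elim (p∤n (p ∣0))
  valuation-¬∣ {n@(suc _)} p∤n with p ∣? n
  ... | yes p∣n = ⊥-elim (p∤n p∣n)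
  ... | no  _   = refl

  valuation-∣ : ∀ n .{{_ : NonZero n}} → p ∣ n → valuation n ≡ suc (valuation (n / p))
  valuation-∣ n@(suc k) p∣n with p ∣? n
  ... | yes _   = cong suc (valuationWithin-irrelevant (n / p) (s≤s⁻¹ (m/n<m n p (nonTrivial⇒n>1 p))) ≤-refl)
  ... | no  p∤n = ⊥-elim (p∤n p∣n)

  valuation-p* : ∀ n .{{_ : NonZero n}} → valuation (p * n) ≡ suc (valuation n)
  valuation-p* n = trans (valuation-∣ (p * n) {{m*n≢0 p n}} (m∣m*n n))
                         (cong (suc ∘ valuation) (m*n/m≡n p n))
    where
    m*n/m≡n : ∀ m n .{{_ : NonZero m}} → m * n / m ≡ n
    m*n/m≡n m n = trans (cong (_/ m) (*-comm m n)) (m*n/n≡m n m)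

  0<valuation⇒∣ : ∀ {n} → 0 < valuation n → p ∣ n
  0<valuation⇒∣ {n} 0<v with p ∣? n
  ... | yes p∣n = p∣n
  ... | no  p∤n = ⊥-elim (<-irrefl (sym (valuation-¬∣ p∤n)) 0<v)

  valuation-1 : valuation 1 ≡ 0
  valuation-1 = valuation-¬∣ λ p∣1 → <⇒≱ (nonTrivial⇒n>1 p) (∣⇒≤ p∣1)

  valuation-*-¬∣ : ∀ {m} .{{_ : NonZero m}} → ¬ p ∣ m → ∀ n .{{_ : NonZero n}} → valuation (m * n) ≡ valuation n
  valuation-*-¬∣ {m} p∤m = /-induction⁺ p P step
    where
    P : ℕ → Set
    P n = valuation (m * n) ≡ valuation n
    step : ∀ n .{{_ : NonZero n}} → (.{{_ : NonZero (n / p)}} → P (n / p)) → P n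
    step n ih with p ∣? n
    ... | no  p∤n = trans (valuation-¬∣ ([ p∤m , p∤n ]′ ∘ euclidsLemma m n p-prime)) (sym (valuation-¬∣ p∤n))
    ... | yes p∣n = begin
      valuation (m * n)             ≡⟨ cong (λ k → valuation (m * k)) (m*[n/m]≡n p∣n) ⟨
      valuation (m * (p * (n / p))) ≡⟨ cong valuation (x*[y*z]≡y*[x*z] m p (n / p)) ⟩
      valuation (p * (m * (n / p))) ≡⟨ valuation-p* (m * (n / p)) {{m*n≢0 m (n / p)}} ⟩
      suc (valuation (m * (n / p))) ≡⟨ cong suc ih ⟩
      suc (valuation (n / p))       ≡⟨ valuation-∣ n p∣n ⟨
      valuation n                   ∎
      where
      open ≡-Reasoning
      instance
        n/p≢0 : NonZero (n / p)
        n/p≢0 = m/n≢0 p∣n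
      x*[y*z]≡y*[x*z] : ∀ x y z → x * (y * z) ≡ y * (x * z)
      x*[y*z]≡y*[x*z] = solve-∀

  valuation-* : ∀ m n .{{_ : NonZero m}} .{{_ : NonZero n}} → valuation (m * n) ≡ valuation m + valuation n
  valuation-* m n = /-induction⁺ p P step m
    where
    P : ℕ → Set
    P m = valuation (m * n) ≡ valuation m + valuation n
    step : ∀ m .{{_ : NonZero m}} → (.{{_ : NonZero (m / p)}} → P (m / p)) → P m
    step m ih with p ∣? m
    ... | no  p∤m = trans (valuation-*-¬∣ p∤m n) (cong (_+ valuation n) (sym (valuation-¬∣ p∤m)))
    ... | yes p∣m = begin
      valuation (m * n)               ≡⟨ cong (λ k → valuation (k * n)) (m*[n/m]≡n p∣m) ⟨
      valuation (p * (m / p) * n)     ≡⟨ cong valuation (*-assoc p (m / p) n) ⟩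
      valuation (p * (m / p * n))     ≡⟨ valuation-p* (m / p * n) {{m*n≢0 (m / p) n}} ⟩
      suc (valuation (m / p * n))     ≡⟨ cong suc ih ⟩
      suc (valuation (m / p)) + valuation n ≡⟨ cong (_+ valuation n) (valuation-∣ m p∣m) ⟨
      valuation m + valuation n       ∎
      where
      open ≡-Reasoning
      instance
        m/p≢0 : NonZero (m / p)
        m/p≢0 = m/n≢0 p∣m

_≤ᵥ_ : ℕ → ℕ → Set
m ≤ᵥ n = ∀ {p} (p-prime : Prime p) → valuation p-prime m ≤ valuation p-prime n

≤ᵥ⇒∣ : ∀ {m n} .{{_ : NonZero m}} .{{_ : NonZero n}} → m ≤ᵥ n → m ∣ n
≤ᵥ⇒∣ {m} {n} m≤ᵥn = subst (_∣ n) (sym isFactorisation) (product∣ factorsPrime n (subst (_≤ᵥ n) isFactorisation m≤ᵥn))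
  where
  open PrimeFactorisation (factorise m)
  product∣ : ∀ {ps} → All Prime ps → ∀ n .{{_ : NonZero n}} → product ps ≤ᵥ n → product ps ∣ n
  product∣ []                    n _  = 1∣ n
  product∣ {p ∷ ps} (p-prime ∷ pps) n ≤ᵥn = subst (p * product ps ∣_) (m*[n/m]≡n p∣n) (*-monoʳ-∣ p (product∣ pps (n / p) ≤ᵥn/p))
    where
    instance
      p≢0 : NonZero p
      p≢0 = prime⇒nonZero p-prime
      ps≢0 : NonZero (product ps)
      ps≢0 = productOfPrimes≢0 pps
    p∣n : p ∣ n
    p∣n = 0<valuation⇒∣ p-prime (<-≤-trans z<s (≤-trans (≤-reflexive (sym (valuation-p* p-prime (product ps)))) (≤ᵥn p-prime)))
    instance
      n/p≢0 : NonZero (n / p)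
      n/p≢0 = m/n≢0 p∣n
    ≤ᵥn/p : product ps ≤ᵥ (n / p)
    ≤ᵥn/p q-prime = +-cancelˡ-≤ (valuation q-prime p) _ _ (begin
      valuation q-prime p + valuation q-prime (product ps) ≡⟨ valuation-* q-prime p (product ps) ⟨
      valuation q-prime (p * product ps)                  ≤⟨ ≤ᵥn q-prime ⟩
      valuation q-prime n                                 ≡⟨ cong (valuation q-prime) (m*[n/m]≡n p∣n) ⟨
      valuation q-prime (p * (n / p))                     ≡⟨ valuation-* q-prime p (n / p) ⟩
      valuation q-prime p + valuation q-prime (n / p)     ∎)
      where open ≤-Reasoning

-- Legendre sums

module _ (b : ℕ) .{{_ : NonTrivial b}} where
  private
    instance
      b≢0 : NonZero b
      b≢0 = nonTrivial⇒nonZero b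

    b>1 : 1 < b
    b>1 = nonTrivial⇒n>1 b

    sumWithin : (ℕ → ℕ) → ℕ → ℕ → ℕ
    sumWithin g _       zero      = 0
    sumWithin g zero    (suc _)   = 0
    sumWithin g (suc k) x@(suc _) = g (x / b) + sumWithin g k (x / b)

    sumWithin-irrelevant : ∀ g {k l} x → x ≤ k → x ≤ l → sumWithin g k x ≡ sumWithin g l x
    sumWithin-irrelevant g zero _ _ = refl
    sumWithin-irrelevant g {suc k} {suc l} x@(suc _) x≤1+k x≤1+l =
      cong (g (x / b) +_) (sumWithin-irrelevant g (x / b) (shrink x≤1+k) (shrink x≤1+l))
      where
      shrink : ∀ {j} → x ≤ suc j → x / b ≤ j
      shrink x≤1+j = s≤s⁻¹ (≤-trans (m/n<m x b b>1) x≤1+j)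

  -- legendreSum g x = Σ_{k ≥ 1} g ⌊x / bᵏ⌋ whenever g 0 ≡ 0 (the recursion stops as soon as x = 0).
  legendreSum : (ℕ → ℕ) → ℕ → ℕ
  legendreSum g x = sumWithin g x x

  legendreSum-unfold : ∀ g x .{{_ : NonZero x}} → legendreSum g x ≡ g (x / b) + legendreSum g (x / b)
  legendreSum-unfold g x@(suc k) =
    cong (g (x / b) +_) (sumWithin-irrelevant g (x / b) (s≤s⁻¹ (m/n<m x b b>1)) ≤-refl)

  legendreSum-unfold₀ : ∀ g → g 0 ≡ 0 → ∀ x → legendreSum g x ≡ g (x / b) + legendreSum g (x / b)
  legendreSum-unfold₀ g g0≡0 zero      = sym (trans (cong (λ y → g y + legendreSum g y) (0/n≡0 b)) (cong (_+ 0) g0≡0))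
  legendreSum-unfold₀ g _    x@(suc _) = legendreSum-unfold g x

  legendreSum-+ : ∀ g h x → legendreSum (λ m → g m + h m) x ≡ legendreSum g x + legendreSum h x
  legendreSum-+ g h = /-induction b _ refl λ x ih → begin
    legendreSum (λ m → g m + h m) x
      ≡⟨ legendreSum-unfold _ x ⟩
    (g (x / b) + h (x / b)) + legendreSum (λ m → g m + h m) (x / b)
      ≡⟨ cong (g (x / b) + h (x / b) +_) ih ⟩
    (g (x / b) + h (x / b)) + (legendreSum g (x / b) + legendreSum h (x / b))
      ≡⟨ +-interchange (g (x / b)) _ _ _ ⟩
    (g (x / b) + legendreSum g (x / b)) + (h (x / b) + legendreSum h (x / b))
      ≡⟨ cong₂ _+_ (legendreSum-unfold g x) (legendreSum-unfold h x) ⟨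
    legendreSum g x + legendreSum h x ∎
    where
    open ≡-Reasoning
    +-interchange : ∀ a b c d → (a + b) + (c + d) ≡ (a + c) + (b + d)
    +-interchange = solve-∀

  legendreSum-mono : ∀ {g h} → (∀ m → g m ≤ h m) → ∀ x → legendreSum g x ≤ legendreSum h x
  legendreSum-mono {g} {h} g≤h = /-induction b _ z≤n λ x ih →
    subst₂ _≤_ (sym (legendreSum-unfold g x)) (sym (legendreSum-unfold h x)) (+-mono-≤ (g≤h (x / b)) ih)

  legendreSum-cong : ∀ {g h} → (∀ m → g m ≡ h m) → ∀ x → legendreSum g x ≡ legendreSum h x
  legendreSum-cong g≡h x = ≤-antisym (legendreSum-mono (≤-reflexive ∘ g≡h) x) (legendreSum-mono (≤-reflexive ∘ sym ∘ g≡h) x)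

  legendreSum-monoʳ : ∀ {g} → (∀ {m n} → m ≤ n → g m ≤ g n) → ∀ {x y} → x ≤ y → legendreSum g x ≤ legendreSum g y
  legendreSum-monoʳ {g} g-mono {x} {y} = /-induction b P (λ _ _ → z≤n) step x y
    where
    P : ℕ → Set
    P x = ∀ y → x ≤ y → legendreSum g x ≤ legendreSum g y
    step : ∀ x .{{_ : NonZero x}} → P (x / b) → P x
    step x ih y x≤y = subst₂ _≤_ (sym (legendreSum-unfold g x)) (sym (legendreSum-unfold g y {{>-nonZero (<-≤-trans (>-nonZero⁻¹ x) x≤y)}}))
      (+-mono-≤ (g-mono (/-monoˡ-≤ b x≤y)) (ih (y / b) (/-monoˡ-≤ b x≤y)))

  legendreSum-/ : ∀ g d .{{_ : NonZero d}} → g 0 ≡ 0 → ∀ x → legendreSum (λ m → g (m / d)) x ≡ legendreSum g (x / d)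
  legendreSum-/ g d g0≡0 = /-induction b _ (cong (legendreSum g) (sym (0/n≡0 d))) λ x ih → begin
    legendreSum (λ m → g (m / d)) x           ≡⟨ legendreSum-unfold _ x ⟩
    g (x / b / d) + legendreSum (λ m → g (m / d)) (x / b) ≡⟨ cong (g (x / b / d) +_) ih ⟩
    g (x / b / d) + legendreSum g (x / b / d) ≡⟨ cong (λ y → g y + legendreSum g y) (m/n/o≡m/o/n x b d) ⟩
    g (x / d / b) + legendreSum g (x / d / b) ≡⟨ legendreSum-unfold₀ g g0≡0 (x / d) ⟨
    legendreSum g (x / d)                     ∎
    where
    open ≡-Reasoning
    m/n/o≡m/o/n : ∀ m n o .{{_ : NonZero n}} .{{_ : NonZero o}} → m / n / o ≡ m / o / n
    m/n/o≡m/o/n m n o = begin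
      m / n / o   ≡⟨ m/n/o≡m/[n*o] m n o ⟩
      m / (n * o) ≡⟨ /-congʳ (*-comm n o) ⟩
      m / (o * n) ≡⟨ m/n/o≡m/[n*o] m o n ⟨
      m / o / n   ∎
      where
      instance
        n*o≢0 : NonZero (n * o)
        n*o≢0 = m*n≢0 n o
        o*n≢0 : NonZero (o * n)
        o*n≢0 = m*n≢0 o n

module _ {p : ℕ} (p-prime : Prime p) where
  private
    instance
      p-nonTrivial : NonTrivial p
      p-nonTrivial = prime⇒nonTrivial p-prime
      p≢0 : NonZero p
      p≢0 = prime⇒nonZero p-prime

    S : ℕ → ℕ
    S = legendreSum p id

    v : ℕ → ℕ
    v = valuation p-prime

    S-suc : ∀ y → S (suc y) ≡ S y + v (suc y)
    S-suc = /-induction p _ base step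
      where
      open ≡-Reasoning
      base : S 1 ≡ S 0 + v 1
      base = begin
        S 1             ≡⟨ legendreSum-unfold p id 1 ⟩
        1 / p + S (1 / p) ≡⟨ cong (λ y → y + S y) (m<n⇒m/n≡0 (nonTrivial⇒n>1 p)) ⟩
        0               ≡⟨ cong (0 +_) (valuation-1 p-prime) ⟨
        S 0 + v 1       ∎
      step : ∀ y .{{_ : NonZero y}} → S (suc (y / p)) ≡ S (y / p) + v (suc (y / p)) → S (suc y) ≡ S y + v (suc y)
      step y ih = by-divisibility (p ∣? suc y)
        where
        by-divisibility : Dec (p ∣ suc y) → S (suc y) ≡ S y + v (suc y)
        by-divisibility (no p∤1+y) = begin
          S (suc y)                 ≡⟨ legendreSum-unfold p id (suc y) ⟩
          suc y / p + S (suc y / p) ≡⟨ cong (λ z → z + S z) ([1+m]/n≡m/n y p p∤1+y) ⟩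
          y / p + S (y / p)         ≡⟨ legendreSum-unfold p id y ⟨
          S y                       ≡⟨ +-identityʳ (S y) ⟨
          S y + 0                   ≡⟨ cong (S y +_) (valuation-¬∣ p-prime p∤1+y) ⟨
          S y + v (suc y)           ∎
        by-divisibility (yes p∣1+y) = begin
          S (suc y)                                   ≡⟨ legendreSum-unfold p id (suc y) ⟩
          suc y / p + S (suc y / p)                   ≡⟨ cong (λ z → z + S z) ([1+m]/n≡1+m/n y p p∣1+y) ⟩
          suc (y / p) + S (suc (y / p))               ≡⟨ cong (suc (y / p) +_) ih ⟩
          suc (y / p) + (S (y / p) + v (suc (y / p))) ≡⟨ rearrange (y / p) _ _ ⟩
          (y / p + S (y / p)) + suc (v (suc (y / p))) ≡⟨ cong₂ _+_ (legendreSum-unfold p id y) (cong (suc ∘ v) ([1+m]/n≡1+m/n y p p∣1+y)) ⟨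
          S y + suc (v (suc y / p))                   ≡⟨ cong (S y +_) (valuation-∣ p-prime (suc y) p∣1+y) ⟨
          S y + v (suc y)                             ∎
          where
          rearrange : ∀ a b c → suc a + (b + c) ≡ (a + b) + suc c
          rearrange = solve-∀

  legendre : ∀ x → valuation p-prime (x !) ≡ legendreSum p id x
  legendre zero    = valuation-1 p-prime
  legendre (suc x) = begin
    v (suc x * x !)     ≡⟨ valuation-* p-prime (suc x) (x !) {{_}} {{x !≢0}} ⟩
    v (suc x) + v (x !) ≡⟨ cong (v (suc x) +_) (legendre x) ⟩
    v (suc x) + S x     ≡⟨ +-comm (v (suc x)) (S x) ⟩
    S x + v (suc x)     ≡⟨ S-suc x ⟨
    S (suc x)           ∎
    where open ≡-Reasoning

-- Chebyshev's quotient

numeratorWeight denominatorWeight ν : ℕ → ℕ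
numeratorWeight   m = m + m / 30
denominatorWeight m = m / 2 + m / 3 + m / 5
ν                 m = numeratorWeight m ∸ denominatorWeight m

sgn : ℕ → ℕ
sgn zero    = 0
sgn (suc _) = 1

by-residue-mod-30 : (P : ℕ → Set) → (∀ r q → P r → P (r + q * 30)) → (∀ {r} → r < 30 → P r) → ∀ m → P m
by-residue-mod-30 P lift residues m =
  subst P (sym (m≡m%n+[m/n]*n m 30)) (lift (m % 30) (m / 30) (residues (m%n<n m 30)))

numeratorWeight-periodic : ∀ r q → numeratorWeight (r + q * 30) ≡ numeratorWeight r + q * 31
numeratorWeight-periodic r q = trans (cong (r + q * 30 +_) ([r+q*n]/d≡r/d+q*k r q {30} {30} {1} refl)) (rearrange r (r / 30) q)
  where
  rearrange : ∀ a b q → a + q * 30 + (b + q * 1) ≡ a + b + q * 31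
  rearrange = solve-∀

denominatorWeight-periodic : ∀ r q → denominatorWeight (r + q * 30) ≡ denominatorWeight r + q * 31
denominatorWeight-periodic r q = begin
  denominatorWeight (r + q * 30)
    ≡⟨ cong₂ _+_ (cong₂ _+_ ([r+q*30]/d 2 15 refl) ([r+q*30]/d 3 10 refl)) ([r+q*30]/d 5 6 refl) ⟩
  r / 2 + q * 15 + (r / 3 + q * 10) + (r / 5 + q * 6) ≡⟨ rearrange (r / 2) (r / 3) (r / 5) q ⟩
  denominatorWeight r + q * 31   ∎
  where
  open ≡-Reasoning
  [r+q*30]/d : ∀ d k .{{_ : NonZero d}} → k * d ≡ 30 → (r + q * 30) / d ≡ r / d + q * k
  [r+q*30]/d d k = [r+q*n]/d≡r/d+q*k r q
  rearrange : ∀ a b c q → a + q * 15 + (b + q * 10) + (c + q * 6) ≡ a + b + c + q * 31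
  rearrange = solve-∀

denominatorWeight≤numeratorWeight : ∀ m → denominatorWeight m ≤ numeratorWeight m
denominatorWeight≤numeratorWeight = by-residue-mod-30 _
  (λ r q le → subst₂ _≤_ (sym (denominatorWeight-periodic r q)) (sym (numeratorWeight-periodic r q)) (+-monoˡ-≤ (q * 31) le))
  (from-yes (allUpTo? (λ r → denominatorWeight r ≤? numeratorWeight r) 30))

numeratorWeight≡denominatorWeight+ν : ∀ m → numeratorWeight m ≡ denominatorWeight m + ν m
numeratorWeight≡denominatorWeight+ν m = sym (m+[n∸m]≡n (denominatorWeight≤numeratorWeight m))

ν-periodic : ∀ r q → ν (r + q * 30) ≡ ν r
ν-periodic r q = begin
  ν (r + q * 30)                                             ≡⟨ cong₂ _∸_ (numeratorWeight-periodic r q) (denominatorWeight-periodic r q) ⟩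
  (numeratorWeight r + q * 31) ∸ (denominatorWeight r + q * 31) ≡⟨ cong₂ _∸_ (+-comm _ (q * 31)) (+-comm _ (q * 31)) ⟩
  (q * 31 + numeratorWeight r) ∸ (q * 31 + denominatorWeight r) ≡⟨ [m+n]∸[m+o]≡n∸o (q * 31) _ _ ⟩
  ν r                                                        ∎
  where open ≡-Reasoning

ν≤sgn : ∀ m → ν m ≤ sgn m
ν≤sgn zero    = z≤n
ν≤sgn (suc m) = by-residue-mod-30 (λ m → ν m ≤ 1)
  (λ r q → subst (_≤ 1) (sym (ν-periodic r q)))
  (from-yes (allUpTo? (λ r → ν r ≤? 1) 30)) (suc m)

-- ν m = 1 for 1 ≤ m < 6.
sgn≤ν+sgn[/6] : ∀ m → sgn m ≤ ν m + sgn (m / 6)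
sgn≤ν+sgn[/6] m with m <? 30
... | yes m<30 = from-yes (allUpTo? (λ r → sgn r ≤? ν r + sgn (r / 6)) 30) m<30
... | no  m≮30 = subst (λ k → sgn m ≤ ν m + sgn k) (suc-pred (m / 6) {{>-nonZero (m≥n⇒m/n>0 6≤m)}}) (≤-trans (sgn≤1 m) (m≤n+m 1 (ν m)))
  where
  sgn≤1 : ∀ m → sgn m ≤ 1
  sgn≤1 zero    = z≤n
  sgn≤1 (suc _) = s≤s z≤n
  6≤m : 6 ≤ m
  6≤m = ≤-trans (from-yes (6 ≤? 30)) (≮⇒≥ m≮30)

chebyshevNumerator chebyshevDenominator : ℕ → ℕ
chebyshevNumerator   x = x ! * (x / 30) !
chebyshevDenominator x = (x / 2) ! * (x / 3) ! * (x / 5) !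

chebyshevNumerator≢0 : ∀ x → NonZero (chebyshevNumerator x)
chebyshevNumerator≢0 x = m*n≢0 _ _ {{x !≢0}} {{(x / 30) !≢0}}

chebyshevDenominator≢0 : ∀ x → NonZero (chebyshevDenominator x)
chebyshevDenominator≢0 x = m*n≢0 _ _ {{(x / 2) !* (x / 3) !≢0}} {{(x / 5) !≢0}}

chebyshev : ℕ → ℕ
chebyshev x = (chebyshevNumerator x / chebyshevDenominator x) {{chebyshevDenominator≢0 x}}

module _ {p : ℕ} (p-prime : Prime p) where
  private
    instance
      p-nonTrivial : NonTrivial p
      p-nonTrivial = prime⇒nonTrivial p-prime

    v : ℕ → ℕ
    v = valuation p-prime

    S : (ℕ → ℕ) → ℕ → ℕ
    S = legendreSum p

    valuation-! : ∀ x d .{{_ : NonZero d}} → v ((x / d) !) ≡ S (_/ d) x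
    valuation-! x d = trans (legendre p-prime (x / d)) (sym (legendreSum-/ p id d refl x))

    valuation-chebyshevNumerator : ∀ x → v (chebyshevNumerator x) ≡ S numeratorWeight x
    valuation-chebyshevNumerator x = begin
      v (x ! * (x / 30) !)          ≡⟨ valuation-* p-prime (x !) ((x / 30) !) {{x !≢0}} {{(x / 30) !≢0}} ⟩
      v (x !) + v ((x / 30) !)      ≡⟨ cong₂ _+_ (legendre p-prime x) (valuation-! x 30) ⟩
      S id x + S (_/ 30) x          ≡⟨ legendreSum-+ p id (_/ 30) x ⟨
      S numeratorWeight x           ∎
      where open ≡-Reasoning

    valuation-chebyshevDenominator : ∀ x → v (chebyshevDenominator x) ≡ S denominatorWeight x
    valuation-chebyshevDenominator x = begin
      v ((x / 2) ! * (x / 3) ! * (x / 5) !)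
        ≡⟨ valuation-* p-prime ((x / 2) ! * (x / 3) !) ((x / 5) !) {{(x / 2) !* (x / 3) !≢0}} {{(x / 5) !≢0}} ⟩
      v ((x / 2) ! * (x / 3) !) + v ((x / 5) !)
        ≡⟨ cong (_+ v ((x / 5) !)) (valuation-* p-prime ((x / 2) !) ((x / 3) !) {{(x / 2) !≢0}} {{(x / 3) !≢0}}) ⟩
      v ((x / 2) !) + v ((x / 3) !) + v ((x / 5) !)
        ≡⟨ cong₂ _+_ (cong₂ _+_ (valuation-! x 2) (valuation-! x 3)) (valuation-! x 5) ⟩
      S (_/ 2) x + S (_/ 3) x + S (_/ 5) x
        ≡⟨ cong (_+ S (_/ 5) x) (legendreSum-+ p (_/ 2) (_/ 3) x) ⟨
      S (λ m → m / 2 + m / 3) x + S (_/ 5) x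
        ≡⟨ legendreSum-+ p (λ m → m / 2 + m / 3) (_/ 5) x ⟨
      S denominatorWeight x ∎
      where open ≡-Reasoning

  valuation-chebyshevNumerator≡denominator+ν : ∀ x → v (chebyshevNumerator x) ≡ v (chebyshevDenominator x) + S ν x
  valuation-chebyshevNumerator≡denominator+ν x = begin
    v (chebyshevNumerator x)                      ≡⟨ valuation-chebyshevNumerator x ⟩
    S numeratorWeight x                           ≡⟨ legendreSum-cong p numeratorWeight≡denominatorWeight+ν x ⟩
    S (λ m → denominatorWeight m + ν m) x         ≡⟨ legendreSum-+ p denominatorWeight ν x ⟩
    S denominatorWeight x + S ν x                 ≡⟨ cong (_+ S ν x) (valuation-chebyshevDenominator x) ⟨
    v (chebyshevDenominator x) + S ν x            ∎
    where open ≡-Reasoning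

chebyshev*denominator≡numerator : ∀ x → chebyshev x * chebyshevDenominator x ≡ chebyshevNumerator x
chebyshev*denominator≡numerator x = m/n*n≡m {{chebyshevDenominator≢0 x}}
  (≤ᵥ⇒∣ {{chebyshevDenominator≢0 x}} {{chebyshevNumerator≢0 x}} λ p-prime →
    ≤-trans (m≤m+n _ _) (≤-reflexive (sym (valuation-chebyshevNumerator≡denominator+ν p-prime x))))

chebyshev≢0 : ∀ x → NonZero (chebyshev x)
chebyshev≢0 x = ≢-nonZero λ F≡0 → ≢-nonZero⁻¹ (chebyshevNumerator x) {{chebyshevNumerator≢0 x}}
  (trans (sym (chebyshev*denominator≡numerator x)) (cong (_* chebyshevDenominator x) F≡0))

module _ {p : ℕ} (p-prime : Prime p) where
  private
    instance
      p-nonTrivial : NonTrivial p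
      p-nonTrivial = prime⇒nonTrivial p-prime
      p≢0 : NonZero p
      p≢0 = prime⇒nonZero p-prime

    v : ℕ → ℕ
    v = valuation p-prime

  valuation-chebyshev : ∀ x → v (chebyshev x) ≡ legendreSum p ν x
  valuation-chebyshev x = +-cancelˡ-≡ (v (chebyshevDenominator x)) _ _ (begin
    v (chebyshevDenominator x) + v (chebyshev x) ≡⟨ +-comm _ (v (chebyshev x)) ⟩
    v (chebyshev x) + v (chebyshevDenominator x)
      ≡⟨ valuation-* p-prime (chebyshev x) (chebyshevDenominator x) {{chebyshev≢0 x}} {{chebyshevDenominator≢0 x}} ⟨
    v (chebyshev x * chebyshevDenominator x)     ≡⟨ cong v (chebyshev*denominator≡numerator x) ⟩
    v (chebyshevNumerator x)                     ≡⟨ valuation-chebyshevNumerator≡denominator+ν p-prime x ⟩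
    v (chebyshevDenominator x) + legendreSum p ν x ∎)
    where open ≡-Reasoning

  -- ilog x = ⌊log_p x⌋ for x ≥ 1.
  ilog : ℕ → ℕ
  ilog = legendreSum p sgn

  private
    ilog-unfold : ∀ x → ilog x ≡ sgn (x / p) + ilog (x / p)
    ilog-unfold = legendreSum-unfold₀ p sgn refl

  ilog-mono : ∀ {x y} → x ≤ y → ilog x ≤ ilog y
  ilog-mono = legendreSum-monoʳ p sgn-mono
    where
    sgn-mono : ∀ {m n} → m ≤ n → sgn m ≤ sgn n
    sgn-mono {zero}              _ = z≤n
    sgn-mono {suc _} {suc _} _ = ≤-refl

  p^k≤x⇒k≤ilog : ∀ k {x} → p ^ k ≤ x → k ≤ ilog x
  p^k≤x⇒k≤ilog zero    _ = z≤n
  p^k≤x⇒k≤ilog (suc k) {x} p^[1+k]≤x = subst (suc k ≤_) (sym (ilog-unfold x)) (from-quotient (x / p) p^k≤x/p)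
    where
    p^k≤x/p : p ^ k ≤ x / p
    p^k≤x/p = m*n≤o⇒m≤o/n (subst (_≤ x) (*-comm p (p ^ k)) p^[1+k]≤x)
    from-quotient : ∀ y → p ^ k ≤ y → suc k ≤ sgn y + ilog y
    from-quotient zero    p^k≤0 = ⊥-elim (<⇒≱ (m^n>0 p k) p^k≤0)
    from-quotient (suc y) p^k≤y = s≤s (p^k≤x⇒k≤ilog k p^k≤y)

  1+k≤ilog⇒p^[1+k]≤x : ∀ k {x} → suc k ≤ ilog x → p ^ suc k ≤ x
  1+k≤ilog⇒p^[1+k]≤x k {x} 1+k≤ilog = subst (_≤ x) (*-comm (p ^ k) p)
    (m≤o/n⇒m*n≤o (to-quotient k (x / p) (subst (suc k ≤_) (ilog-unfold x) 1+k≤ilog)))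
    where
    to-quotient : ∀ k y → suc k ≤ sgn y + ilog y → p ^ k ≤ y
    to-quotient zero    (suc y) _    = s≤s z≤n
    to-quotient (suc k) (suc y) 2+k≤ = 1+k≤ilog⇒p^[1+k]≤x k (s≤s⁻¹ 2+k≤)

  p≤x⇒1≤ilog : ∀ {x} → p ≤ x → 1 ≤ ilog x
  p≤x⇒1≤ilog p≤x = p^k≤x⇒k≤ilog 1 (subst (_≤ _) (sym (*-identityʳ p)) p≤x)

  ilog-gap : ∀ {Y Z R} → Z < 2 * Y → Z ≤ R * R → p ≤ Y ⊎ Z < p → ilog Z ≤ ilog Y + ilog R
  ilog-gap {Y} {Z} {R} Z<2Y Z≤R*R p∉⟨Y,Z] with ilog Z in ilogZ≡
  ... | zero   = z≤n
  ... | 1      = [ (λ p≤Y → ≤-trans (p≤x⇒1≤ilog p≤Y) (m≤m+n (ilog Y) (ilog R))) , (λ Z<p → ⊥-elim (<⇒≱ Z<p p≤Z)) ]′ p∉⟨Y,Z]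
    where
    p≤Z : p ≤ Z
    p≤Z = subst (_≤ Z) (*-identityʳ p) (1+k≤ilog⇒p^[1+k]≤x 0 (≤-reflexive (sym ilogZ≡)))
  ... | 2+ j   = subst (_≤ ilog Y + ilog R) (+-comm (suc j) 1) (+-mono-≤ (p^k≤x⇒k≤ilog (suc j) (<⇒≤ p^[1+j]<Y)) (p≤x⇒1≤ilog p≤R))
    where
    p^[2+j]≤Z : p ^ 2+ j ≤ Z
    p^[2+j]≤Z = 1+k≤ilog⇒p^[1+k]≤x (suc j) (≤-reflexive (sym ilogZ≡))
    p^[1+j]<Y : p ^ suc j < Y
    p^[1+j]<Y = *-cancelˡ-< 2 _ _ (≤-<-trans (≤-trans (*-monoˡ-≤ (p ^ suc j) (nonTrivial⇒n>1 p)) p^[2+j]≤Z) Z<2Y)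
    p≤p^[1+j] : p ≤ p ^ suc j
    p≤p^[1+j] = subst (_≤ p ^ suc j) (*-identityʳ p) (^-monoʳ-≤ p {1} {suc j} (s≤s z≤n))
    p≤R : p ≤ R
    p≤R = ≮⇒≥ λ R<p → <⇒≱ (*-mono-< R<p R<p) (≤-trans (*-monoʳ-≤ p p≤p^[1+j]) (≤-trans p^[2+j]≤Z Z≤R*R))

  valuation-chebyshev≤ilog : ∀ x → v (chebyshev x) ≤ ilog x
  valuation-chebyshev≤ilog x = subst (_≤ ilog x) (sym (valuation-chebyshev x)) (legendreSum-mono p ν≤sgn x)

  ilog≤valuation-chebyshev+ilog : ∀ x → ilog x ≤ v (chebyshev x) + ilog (x / 6)
  ilog≤valuation-chebyshev+ilog x = begin
    ilog x                                             ≤⟨ legendreSum-mono p sgn≤ν+sgn[/6] x ⟩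
    legendreSum p (λ m → ν m + sgn (m / 6)) x          ≡⟨ legendreSum-+ p ν (λ m → sgn (m / 6)) x ⟩
    legendreSum p ν x + legendreSum p (λ m → sgn (m / 6)) x ≡⟨ cong₂ _+_ (sym (valuation-chebyshev x)) (legendreSum-/ p sgn 6 refl x) ⟩
    v (chebyshev x) + ilog (x / 6)                     ∎
    where open ≤-Reasoning

-- Binomial estimates

private
  module ℕ-Semiring = CommutativeSemiring +-*-commutativeSemiring

Σ : ∀ {n} → (Fin n → ℕ) → ℕ
Σ = RawMonoid.sum ℕ-Semiring.+-rawMonoid

Σ-mono : ∀ {n} {f g : Fin n → ℕ} → (∀ i → f i ≤ g i) → Σ f ≤ Σ g
Σ-mono {zero}  _   = z≤n
Σ-mono {suc n} f≤g = +-mono-≤ (f≤g zero) (Σ-mono (f≤g ∘ suc))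

Σ-cong : ∀ {n} {f g : Fin n → ℕ} → (∀ i → f i ≡ g i) → Σ f ≡ Σ g
Σ-cong f≡g = ≤-antisym (Σ-mono (≤-reflexive ∘ f≡g)) (Σ-mono (≤-reflexive ∘ sym ∘ f≡g))

Σ-term : ∀ {n} (f : Fin n → ℕ) i → f i ≤ Σ f
Σ-term f zero    = m≤m+n (f zero) _
Σ-term f (suc i) = ≤-trans (Σ-term (f ∘ suc) i) (m≤n+m _ (f zero))

Σ≤n*max : ∀ {n} (f : Fin n → ℕ) {M} → (∀ i → f i ≤ M) → Σ f ≤ n * M
Σ≤n*max {zero}  f _     = z≤n
Σ≤n*max {suc n} f f≤M = +-mono-≤ (f≤M zero) (Σ≤n*max (f ∘ suc) (f≤M ∘ suc))

*-distribˡ-Σ : ∀ {n} m (f : Fin n → ℕ) → m * Σ f ≡ Σ (λ i → m * f i)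
*-distribˡ-Σ {zero}  m f = *-zeroʳ m
*-distribˡ-Σ {suc n} m f = trans (*-distribˡ-+ m (f zero) _) (cong (m * f zero +_) (*-distribˡ-Σ m (f ∘ suc)))

binomialTerm : ℕ → ℕ → ℕ → ℕ → ℕ
binomialTerm a b n j = (n C j) * (a ^ j * b ^ (n ∸ j))

binomial-theorem : ∀ a b n → (a + b) ^ n ≡ Σ (λ (j : Fin (suc n)) → binomialTerm a b n (toℕ j))
binomial-theorem a b n = trans (sym (^≡^ (a + b) n)) (trans (Binomial.theorem +-*-commutativeSemiring n a b)
  (Σ-cong {suc n} λ j → trans (×≡* (n C toℕ j) _) (cong ((n C toℕ j) *_) (cong₂ _*_ (^≡^ a (toℕ j)) (^≡^ b (n ∸ toℕ j))))))
  where
  ^≡^ : ∀ x m → RawSemiring._^_ ℕ-Semiring.rawSemiring x m ≡ x ^ m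
  ^≡^ x zero    = refl
  ^≡^ x (suc m) = cong (x *_) (^≡^ x m)
  ×≡* : ∀ m x → RawMonoid._×_ ℕ-Semiring.+-rawMonoid m x ≡ m * x
  ×≡* zero    x = refl
  ×≡* (suc m) x = cong (x +_) (×≡* m x)

binomialTerm≤ : ∀ a b {n j} → j ≤ n → binomialTerm a b n j ≤ (a + b) ^ n
binomialTerm≤ a b {n} {j} j≤n = subst₂ _≤_ (cong (binomialTerm a b n) (toℕ-fromℕ< (s≤s j≤n))) (sym (binomial-theorem a b n))
  (Σ-term (λ (i : Fin (suc n)) → binomialTerm a b n (toℕ i)) (fromℕ< (s≤s j≤n)))

^≤[1+n]*max : ∀ a b n {M} → (∀ j → j ≤ n → binomialTerm a b n j ≤ M) → (a + b) ^ n ≤ suc n * M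
^≤[1+n]*max a b n terms≤M = subst (_≤ suc n * _) (sym (binomial-theorem a b n))
  (Σ≤n*max (λ (i : Fin (suc n)) → binomialTerm a b n (toℕ i)) (λ i → terms≤M (toℕ i) (s≤s⁻¹ (toℕ<n i))))

C*!*!≡! : ∀ k l {n} → k + l ≡ n → (n C k) * (k ! * l !) ≡ n !
C*!*!≡! k l refl = begin
  ((k + l) C k) * (k ! * l !)                 ≡⟨ cong (λ m → ((k + l) C k) * (k ! * m !)) (m+n∸m≡n k l) ⟨
  ((k + l) C k) * (k ! * (k + l ∸ k) !)        ≡⟨ cong (_* (k ! * (k + l ∸ k) !)) (nCk≡n!/k![n-k]! k≤k+l) ⟩
  (k + l) ! / (k ! * (k + l ∸ k) !) * (k ! * (k + l ∸ k) !) ≡⟨ m/n*n≡m (k![n∸k]!∣n! k≤k+l) ⟩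
  (k + l) !                                    ∎
  where
  open ≡-Reasoning
  k≤k+l = m≤m+n k l
  instance
    k![k+l∸k]!≢0 : NonZero (k ! * (k + l ∸ k) !)
    k![k+l∸k]!≢0 = k !* (k + l ∸ k) !≢0

C-absorb : ∀ j e → ((suc j + e) C suc j) * suc j ≡ ((suc j + e) C j) * suc e
C-absorb j e = *-cancelʳ-≡ _ _ (j ! * e !) {{j !* e !≢0}} (begin
  ((suc j + e) C suc j) * suc j * (j ! * e !)  ≡⟨ rearrange ((suc j + e) C suc j) (suc j) (j !) (e !) ⟩
  ((suc j + e) C suc j) * (suc j ! * e !)      ≡⟨ C*!*!≡! (suc j) e refl ⟩
  (suc j + e) !                                ≡⟨ C*!*!≡! j (suc e) (+-suc j e) ⟨
  ((suc j + e) C j) * (j ! * suc e !)          ≡⟨ rearrange′ ((suc j + e) C j) (suc e) (j !) (e !) ⟨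
  ((suc j + e) C j) * suc e * (j ! * e !)      ∎)
  where
  open ≡-Reasoning
  rearrange : ∀ c s f g → c * s * (f * g) ≡ c * (s * f * g)
  rearrange = solve-∀
  rearrange′ : ∀ c s f g → c * s * (f * g) ≡ c * (f * (s * g))
  rearrange′ = solve-∀

binomialTerm-ratio : ∀ a b j e → binomialTerm a b (suc j + e) (suc j) * (suc j * b) ≡ binomialTerm a b (suc j + e) j * (suc e * a)
binomialTerm-ratio a b j e = begin
  (n C suc j) * (a ^ suc j * b ^ (n ∸ suc j)) * (suc j * b)
    ≡⟨ cong (λ m → (n C suc j) * (a ^ suc j * b ^ m) * (suc j * b)) (m+n∸m≡n (suc j) e) ⟩
  (n C suc j) * (a ^ suc j * b ^ e) * (suc j * b)            ≡⟨ rearrange (n C suc j) (suc j) a (a ^ j) b (b ^ e) ⟩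
  (n C suc j) * suc j * (a * (a ^ j * (b * b ^ e)))          ≡⟨ cong (_* (a * (a ^ j * (b * b ^ e)))) (C-absorb j e) ⟩
  (n C j) * suc e * (a * (a ^ j * (b * b ^ e)))              ≡⟨ rearrange′ (n C j) (suc e) a (a ^ j) (b * b ^ e) ⟨
  (n C j) * (a ^ j * b ^ suc e) * (suc e * a)                ≡⟨ cong (λ m → (n C j) * (a ^ j * b ^ m) * (suc e * a)) n∸j≡1+e ⟨
  (n C j) * (a ^ j * b ^ (n ∸ j)) * (suc e * a)              ∎
  where
  open ≡-Reasoning
  n = suc j + e
  n∸j≡1+e : n ∸ j ≡ suc e
  n∸j≡1+e = trans (cong (_∸ j) (sym (+-suc j e))) (m+n∸m≡n j (suc e))
  rearrange : ∀ c s a aʲ b bᵉ → c * (a * aʲ * bᵉ) * (s * b) ≡ c * s * (a * (aʲ * (b * bᵉ)))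
  rearrange = solve-∀
  rearrange′ : ∀ c s a aʲ bb → c * (aʲ * bb) * (s * a) ≡ c * s * (a * (aʲ * bb))
  rearrange′ = solve-∀

-- When k b = l a, the k-th term of (a + b)^(k + l) is the largest one.
module CentralBinomialTerm (a b k l : ℕ) .{{_ : NonZero b}} (balanced : k * b ≡ l * a) where
  private
    n = k + l

    T : ℕ → ℕ
    T = binomialTerm a b n

    ratio : ∀ j e → suc j + e ≡ n → T (suc j) * (suc j * b) ≡ T j * (suc e * a)
    ratio j e eq = subst (λ m → binomialTerm a b m (suc j) * (suc j * b) ≡ binomialTerm a b m j * (suc e * a)) eq
      (binomialTerm-ratio a b j e)

    open ≤-Reasoning

    increasing : ∀ j → j < k → T j ≤ T (suc j)
    increasing j j<k with m≤n⇒∃[o]m+o≡n j<k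
    ... | d , 1+j+d≡k = *-cancelʳ-≤ (T j) (T (suc j)) (suc j * b) {{m*n≢0 (suc j) b}} (begin
      T j * (suc j * b)           ≤⟨ *-monoʳ-≤ (T j) 1+j*b≤[1+d+l]*a ⟩
      T j * (suc (d + l) * a)     ≡⟨ ratio j (d + l) (trans (sym (+-assoc (suc j) d l)) (cong (_+ l) 1+j+d≡k)) ⟨
      T (suc j) * (suc j * b)     ∎)
      where
      1+j*b≤[1+d+l]*a : suc j * b ≤ suc (d + l) * a
      1+j*b≤[1+d+l]*a = begin
        suc j * b       ≤⟨ *-monoˡ-≤ b (m≤m+n (suc j) d) ⟩
        (suc j + d) * b ≡⟨ cong (_* b) 1+j+d≡k ⟩
        k * b           ≡⟨ balanced ⟩
        l * a           ≤⟨ *-monoˡ-≤ a (≤-trans (m≤n+m l d) (n≤1+n (d + l))) ⟩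
        suc (d + l) * a ∎

    decreasing : ∀ j → k ≤ j → j < n → T (suc j) ≤ T j
    decreasing j k≤j j<n with m≤n⇒∃[o]m+o≡n k≤j | m≤n⇒∃[o]m+o≡n j<n
    ... | d , k+d≡j | e , 1+j+e≡n = *-cancelʳ-≤ (T (suc j)) (T j) (suc j * b) {{m*n≢0 (suc j) b}} (begin
      T (suc j) * (suc j * b)     ≡⟨ ratio j e 1+j+e≡n ⟩
      T j * (suc e * a)           ≤⟨ *-monoʳ-≤ (T j) [1+e]*a≤[1+j]*b ⟩
      T j * (suc j * b)           ∎)
      where
      l≡1+d+e : l ≡ suc (d + e)
      l≡1+d+e = +-cancelˡ-≡ k _ _ (begin-equality
        k + l             ≡⟨ 1+j+e≡n ⟨
        suc j + e         ≡⟨ cong (λ m → suc m + e) k+d≡j ⟨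
        suc (k + d) + e   ≡⟨ rearrange k d e ⟩
        k + suc (d + e)   ∎)
        where
        rearrange : ∀ k d e → suc (k + d) + e ≡ k + suc (d + e)
        rearrange = solve-∀
      [1+e]*a≤[1+j]*b : suc e * a ≤ suc j * b
      [1+e]*a≤[1+j]*b = begin
        suc e * a       ≤⟨ *-monoˡ-≤ a (s≤s (m≤n+m e d)) ⟩
        suc (d + e) * a ≡⟨ cong (_* a) l≡1+d+e ⟨
        l * a           ≡⟨ balanced ⟨
        k * b           ≤⟨ *-monoˡ-≤ b (≤-trans k≤j (n≤1+n j)) ⟩
        suc j * b       ∎

    rising : ∀ d j → j + d ≡ k → T j ≤ T k
    rising zero    j j+0≡k = ≤-reflexive (cong T (trans (sym (+-identityʳ j)) j+0≡k))
    rising (suc d) j j+1+d≡k = ≤-trans (increasing j (subst (j <_) j+1+d≡k (m<m+n j z<s)))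
                                        (rising d (suc j) (trans (sym (+-suc j d)) j+1+d≡k))

    falling : ∀ d → k + d ≤ n → T (k + d) ≤ T k
    falling zero    _        = ≤-reflexive (cong T (+-identityʳ k))
    falling (suc d) k+1+d≤n = begin
      T (k + suc d)   ≡⟨ cong T (+-suc k d) ⟩
      T (suc (k + d)) ≤⟨ decreasing (k + d) (m≤m+n k d) (subst (_≤ n) (+-suc k d) k+1+d≤n) ⟩
      T (k + d)       ≤⟨ falling d (≤-trans (m≤m+n (k + d) 1) (subst (_≤ n) (trans (+-suc k d) (+-comm 1 (k + d))) k+1+d≤n)) ⟩
      T k             ∎

    binomialTerm≤central : ∀ j → j ≤ n → T j ≤ T k
    binomialTerm≤central j j≤n with j ≤? k
    ... | yes j≤k = let d , j+d≡k = m≤n⇒∃[o]m+o≡n j≤k in rising d j j+d≡k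
    ... | no  j≰k = let d , k+d≡j = m≤n⇒∃[o]m+o≡n (≰⇒≥ j≰k) in
      subst (λ i → T i ≤ T k) k+d≡j (falling d (subst (_≤ n) (sym k+d≡j) j≤n))

  central≤ : (n C k) * (a ^ k * b ^ l) ≤ (a + b) ^ n
  central≤ = subst (λ m → (n C k) * (a ^ k * b ^ m) ≤ (a + b) ^ n) (m+n∸m≡n k l) (binomialTerm≤ a b (m≤m+n k l))

  ≤[1+n]*central : (a + b) ^ n ≤ suc n * ((n C k) * (a ^ k * b ^ l))
  ≤[1+n]*central = subst (λ m → (a + b) ^ n ≤ suc n * ((n C k) * (a ^ k * b ^ m))) (m+n∸m≡n k l)
    (^≤[1+n]*max a b n binomialTerm≤central)

central-bounds : ∀ β k {l n} .{{_ : NonZero β}} → k * β ≡ l → k + l ≡ n →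
                 (n C k) * β ^ l ≤ suc β ^ n × suc β ^ n ≤ suc n * ((n C k) * β ^ l)
central-bounds β k refl refl =
  subst (_≤ suc β ^ n) C[1^k*β^l]≡Cβ^l central≤ ,
  subst (λ m → suc β ^ n ≤ suc n * m) C[1^k*β^l]≡Cβ^l ≤[1+n]*central
  where
  open CentralBinomialTerm 1 β k (k * β) (sym (*-identityʳ (k * β)))
  n = k + k * β
  C[1^k*β^l]≡Cβ^l : (n C k) * (1 ^ k * β ^ (k * β)) ≡ (n C k) * β ^ (k * β)
  C[1^k*β^l]≡Cβ^l = cong (λ m → (n C k) * m) (trans (cong (_* β ^ (k * β)) (^-zeroˡ k)) (*-identityˡ _))

private
  15t+15t≡30t : ∀ t → 15 * t + 15 * t ≡ 30 * t
  15t+15t≡30t = solve-∀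
  5t+10t≡15t : ∀ t → 5 * t + 10 * t ≡ 15 * t
  5t+10t≡15t = solve-∀
  t+5t≡6t : ∀ t → t + 5 * t ≡ 6 * t
  t+5t≡6t = solve-∀

module _ (t : ℕ) where
  private
    C₂ C₃ C₆ : ℕ
    C₂ = (30 * t) C (15 * t)
    C₃ = (15 * t) C (5 * t)
    C₆ = (6 * t) C t

    C₂-bounds : C₂ * 1 ^ (15 * t) ≤ 2 ^ (30 * t) × 2 ^ (30 * t) ≤ suc (30 * t) * (C₂ * 1 ^ (15 * t))
    C₂-bounds = central-bounds 1 (15 * t) (*-identityʳ (15 * t)) (15t+15t≡30t t)

    C₃-bounds : C₃ * 2 ^ (10 * t) ≤ 3 ^ (15 * t) × 3 ^ (15 * t) ≤ suc (15 * t) * (C₃ * 2 ^ (10 * t))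
    C₃-bounds = central-bounds 2 (5 * t) (5t*2≡10t t) (5t+10t≡15t t)
      where
      5t*2≡10t : ∀ t → 5 * t * 2 ≡ 10 * t
      5t*2≡10t = solve-∀

    C₆-bounds : C₆ * 5 ^ (5 * t) ≤ 6 ^ (6 * t) × 6 ^ (6 * t) ≤ suc (6 * t) * (C₆ * 5 ^ (5 * t))
    C₆-bounds = central-bounds 5 t (*-comm t 5) (t+5t≡6t t)

    C₂*1^≡C₂ : C₂ * 1 ^ (15 * t) ≡ C₂
    C₂*1^≡C₂ = trans (cong (C₂ *_) (^-zeroˡ (15 * t))) (*-identityʳ C₂)

    30t/d≡ct : ∀ c d .{{_ : NonZero d}} → c * d ≡ 30 → 30 * t / d ≡ c * t
    30t/d≡ct c d c*d≡30 = trans (cong (_/ d) (trans (cong (_* t) (sym c*d≡30)) (rearrange c d t))) (m*n/n≡m (c * t) d)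
      where
      rearrange : ∀ c d t → c * d * t ≡ c * t * d
      rearrange = solve-∀

    chebyshev*C₆≡C₂*C₃ : chebyshev (30 * t) * C₆ ≡ C₂ * C₃
    chebyshev*C₆≡C₂*C₃ = *-cancelʳ-≡ _ _ X {{X≢0}} (begin
      F * C₆ * X                                    ≡⟨ rearrange F C₆ ((15 * t) !) ((10 * t) !) (t !) ((5 * t) !) ⟩
      F * ((15 * t) ! * (10 * t) ! * (C₆ * (t ! * (5 * t) !)))
        ≡⟨ cong (λ m → F * ((15 * t) ! * (10 * t) ! * m)) (C*!*!≡! t (5 * t) (t+5t≡6t t)) ⟩
      F * ((15 * t) ! * (10 * t) ! * (6 * t) !)          ≡⟨ cong (F *_) denominator≡ ⟨
      F * chebyshevDenominator (30 * t)            ≡⟨ chebyshev*denominator≡numerator (30 * t) ⟩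
      (30 * t) ! * (30 * t / 30) !                 ≡⟨ cong (λ m → (30 * t) ! * m !) (trans (30t/d≡ct 1 30 refl) (*-identityˡ t)) ⟩
      (30 * t) ! * t !                             ≡⟨ cong (_* t !) (C*!*!≡! (15 * t) (15 * t) (15t+15t≡30t t)) ⟨
      C₂ * ((15 * t) ! * (15 * t) !) * t !         ≡⟨ cong (λ m → C₂ * ((15 * t) ! * m) * t !) (C*!*!≡! (5 * t) (10 * t) (5t+10t≡15t t)) ⟨
      C₂ * ((15 * t) ! * (C₃ * ((5 * t) ! * (10 * t) !))) * t ! ≡⟨ rearrange′ C₂ C₃ ((15 * t) !) ((10 * t) !) (t !) ((5 * t) !) ⟩
      C₂ * C₃ * X ∎)
      where
      open ≡-Reasoning
      F = chebyshev (30 * t)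
      X = (15 * t) ! * (10 * t) ! * t ! * (5 * t) !
      X≢0 : NonZero X
      X≢0 = m*n≢0 _ _ {{m*n≢0 _ _ {{(15 * t) !* (10 * t) !≢0}} {{t !≢0}}}} {{(5 * t) !≢0}}
      rearrange : ∀ f c a b d e → f * c * (a * b * d * e) ≡ f * (a * b * (c * (d * e)))
      rearrange = solve-∀
      rearrange′ : ∀ c₂ c₃ a b d e → c₂ * (a * (c₃ * (e * b))) * d ≡ c₂ * c₃ * (a * b * d * e)
      rearrange′ = solve-∀
      denominator≡ : chebyshevDenominator (30 * t) ≡ (15 * t) ! * (10 * t) ! * (6 * t) !
      denominator≡ = cong₂ _*_ (cong₂ _*_ (cong _! (30t/d≡ct 15 2 refl)) (cong _! (30t/d≡ct 10 3 refl))) (cong _! (30t/d≡ct 6 5 refl))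

    W : ℕ
    W = 6 ^ (6 * t) * 2 ^ (10 * t)

    W≢0 : NonZero W
    W≢0 = m*n≢0 _ _ {{m^n≢0 6 (6 * t)}} {{m^n≢0 2 (10 * t)}}

    [2^30*3^15*5^5]^t : (2 ^ 30 * 3 ^ 15 * 5 ^ 5) ^ t ≡ 2 ^ (30 * t) * 3 ^ (15 * t) * 5 ^ (5 * t)
    [2^30*3^15*5^5]^t = begin
      (2 ^ 30 * 3 ^ 15 * 5 ^ 5) ^ t                   ≡⟨ ^-distribʳ-* (2 ^ 30 * 3 ^ 15) (5 ^ 5) t ⟩
      (2 ^ 30 * 3 ^ 15) ^ t * (5 ^ 5) ^ t             ≡⟨ cong (_* (5 ^ 5) ^ t) (^-distribʳ-* (2 ^ 30) (3 ^ 15) t) ⟩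
      (2 ^ 30) ^ t * (3 ^ 15) ^ t * (5 ^ 5) ^ t       ≡⟨ cong₂ _*_ (cong₂ _*_ (^-*-assoc 2 30 t) (^-*-assoc 3 15 t)) (^-*-assoc 5 5 t) ⟩
      2 ^ (30 * t) * 3 ^ (15 * t) * 5 ^ (5 * t)       ∎
      where open ≡-Reasoning

    [2^c*6^6*2^10]^t : ∀ c → (2 ^ c * (6 ^ 6 * 2 ^ 10)) ^ t ≡ 2 ^ (c * t) * W
    [2^c*6^6*2^10]^t c = begin
      (2 ^ c * (6 ^ 6 * 2 ^ 10)) ^ t                  ≡⟨ ^-distribʳ-* (2 ^ c) (6 ^ 6 * 2 ^ 10) t ⟩
      (2 ^ c) ^ t * (6 ^ 6 * 2 ^ 10) ^ t              ≡⟨ cong ((2 ^ c) ^ t *_) (^-distribʳ-* (6 ^ 6) (2 ^ 10) t) ⟩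
      (2 ^ c) ^ t * ((6 ^ 6) ^ t * (2 ^ 10) ^ t)      ≡⟨ cong₂ _*_ (^-*-assoc 2 c t) (cong₂ _*_ (^-*-assoc 6 6 t) (^-*-assoc 2 10 t)) ⟩
      2 ^ (c * t) * W                                 ∎
      where open ≡-Reasoning

  -- F(30t) = C(30t, 15t) C(15t, 5t) / C(6t, t), and 2^39 ≤ 2^30 3^15 5^5 / (6^6 2^10) ≤ 2^40.
  chebyshev-upper : chebyshev (30 * t) ≤ suc (6 * t) * 2 ^ (40 * t)
  chebyshev-upper = *-cancelʳ-≤ _ _ W {{W≢0}} (begin
    F * W                                              ≡⟨ *-assoc F _ _ ⟨
    F * 6 ^ (6 * t) * 2 ^ (10 * t)                      ≤⟨ *-monoˡ-≤ (2 ^ (10 * t)) (*-monoʳ-≤ F (proj₂ C₆-bounds)) ⟩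
    F * (suc (6 * t) * (C₆ * 5 ^ (5 * t))) * 2 ^ (10 * t) ≡⟨ rearrange F (suc (6 * t)) C₆ (5 ^ (5 * t)) (2 ^ (10 * t)) ⟩
    suc (6 * t) * (F * C₆) * 2 ^ (10 * t) * 5 ^ (5 * t) ≡⟨ cong (λ m → suc (6 * t) * m * 2 ^ (10 * t) * 5 ^ (5 * t)) chebyshev*C₆≡C₂*C₃ ⟩
    suc (6 * t) * (C₂ * C₃) * 2 ^ (10 * t) * 5 ^ (5 * t) ≡⟨ rearrange′ (suc (6 * t)) C₂ C₃ (2 ^ (10 * t)) (5 ^ (5 * t)) ⟩
    suc (6 * t) * (C₂ * (C₃ * 2 ^ (10 * t)) * 5 ^ (5 * t))
      ≤⟨ *-monoʳ-≤ (suc (6 * t)) (*-monoˡ-≤ (5 ^ (5 * t)) (*-mono-≤ C₂≤2^30t (proj₁ C₃-bounds))) ⟩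
    suc (6 * t) * (2 ^ (30 * t) * 3 ^ (15 * t) * 5 ^ (5 * t)) ≡⟨ cong (suc (6 * t) *_) [2^30*3^15*5^5]^t ⟨
    suc (6 * t) * (2 ^ 30 * 3 ^ 15 * 5 ^ 5) ^ t
      ≤⟨ *-monoʳ-≤ (suc (6 * t)) (^-monoˡ-≤ t (from-yes (2 ^ 30 * 3 ^ 15 * 5 ^ 5 ≤? 2 ^ 40 * (6 ^ 6 * 2 ^ 10)))) ⟩
    suc (6 * t) * (2 ^ 40 * (6 ^ 6 * 2 ^ 10)) ^ t       ≡⟨ cong (suc (6 * t) *_) ([2^c*6^6*2^10]^t 40) ⟩
    suc (6 * t) * (2 ^ (40 * t) * W)                    ≡⟨ *-assoc (suc (6 * t)) (2 ^ (40 * t)) W ⟨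
    suc (6 * t) * 2 ^ (40 * t) * W                      ∎)
    where
    open ≤-Reasoning
    F = chebyshev (30 * t)
    C₂≤2^30t : C₂ ≤ 2 ^ (30 * t)
    C₂≤2^30t = subst (_≤ 2 ^ (30 * t)) C₂*1^≡C₂ (proj₁ C₂-bounds)
    rearrange : ∀ f s c a b → f * (s * (c * a)) * b ≡ s * (f * c) * b * a
    rearrange = solve-∀
    rearrange′ : ∀ s a b c d → s * (a * b) * c * d ≡ s * (a * (b * c) * d)
    rearrange′ = solve-∀

  chebyshev-lower : 2 ^ (39 * t) ≤ suc (30 * t) * suc (15 * t) * chebyshev (30 * t)
  chebyshev-lower = *-cancelʳ-≤ _ _ W {{W≢0}} (begin
    2 ^ (39 * t) * W                                   ≡⟨ [2^c*6^6*2^10]^t 39 ⟨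
    (2 ^ 39 * (6 ^ 6 * 2 ^ 10)) ^ t                     ≤⟨ ^-monoˡ-≤ t (from-yes (2 ^ 39 * (6 ^ 6 * 2 ^ 10) ≤? 2 ^ 30 * 3 ^ 15 * 5 ^ 5)) ⟩
    (2 ^ 30 * 3 ^ 15 * 5 ^ 5) ^ t                       ≡⟨ [2^30*3^15*5^5]^t ⟩
    2 ^ (30 * t) * 3 ^ (15 * t) * 5 ^ (5 * t)           ≤⟨ *-monoˡ-≤ (5 ^ (5 * t)) (*-mono-≤ 2^30t≤ (proj₂ C₃-bounds)) ⟩
    suc (30 * t) * C₂ * (suc (15 * t) * (C₃ * 2 ^ (10 * t))) * 5 ^ (5 * t)
      ≡⟨ rearrange (suc (30 * t)) C₂ (suc (15 * t)) C₃ (2 ^ (10 * t)) (5 ^ (5 * t)) ⟩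
    suc (30 * t) * suc (15 * t) * (C₂ * C₃) * (5 ^ (5 * t) * 2 ^ (10 * t))
      ≡⟨ cong (λ m → suc (30 * t) * suc (15 * t) * m * (5 ^ (5 * t) * 2 ^ (10 * t))) chebyshev*C₆≡C₂*C₃ ⟨
    suc (30 * t) * suc (15 * t) * (F * C₆) * (5 ^ (5 * t) * 2 ^ (10 * t))
      ≡⟨ rearrange′ (suc (30 * t) * suc (15 * t)) F C₆ (5 ^ (5 * t)) (2 ^ (10 * t)) ⟩
    suc (30 * t) * suc (15 * t) * F * (C₆ * 5 ^ (5 * t) * 2 ^ (10 * t))
      ≤⟨ *-monoʳ-≤ (suc (30 * t) * suc (15 * t) * F) (*-monoˡ-≤ (2 ^ (10 * t)) (proj₁ C₆-bounds)) ⟩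
    suc (30 * t) * suc (15 * t) * F * W                 ∎)
    where
    open ≤-Reasoning
    F = chebyshev (30 * t)
    2^30t≤ : 2 ^ (30 * t) ≤ suc (30 * t) * C₂
    2^30t≤ = subst (λ m → 2 ^ (30 * t) ≤ suc (30 * t) * m) C₂*1^≡C₂ (proj₂ C₂-bounds)
    rearrange : ∀ a c b d e f → a * c * (b * (d * e)) * f ≡ a * b * (c * d) * (f * e)
    rearrange = solve-∀
    rearrange′ : ∀ x f c a b → x * (f * c) * (a * b) ≡ x * f * (c * a * b)
    rearrange′ = solve-∀

-- Multiples of lcm(1, …, 30t)

≤2^-induction : ∀ (f : ℕ → ℕ) {u₀} → f u₀ ≤ 2 ^ u₀ → (∀ u → u₀ ≤ u → f (suc u) ≤ 2 * f u) →
                ∀ {u} → u₀ ≤ u → f u ≤ 2 ^ u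
≤2^-induction f {u₀} base step u₀≤u with m≤n⇒∃[o]m+o≡n u₀≤u
... | d , refl = go d
  where
  go : ∀ d → f (u₀ + d) ≤ 2 ^ (u₀ + d)
  go zero    = subst (λ u → f u ≤ 2 ^ u) (sym (+-identityʳ u₀)) base
  go (suc d) = subst (λ u → f u ≤ 2 ^ u) (sym (+-suc u₀ d))
    (≤-trans (step (u₀ + d) (m≤m+n u₀ d)) (*-monoʳ-≤ 2 (go d)))

36u+31≤2^u : ∀ {u} → 9 ≤ u → 36 * u + 31 ≤ 2 ^ u
36u+31≤2^u = ≤2^-induction (λ u → 36 * u + 31) (from-yes (36 * 9 + 31 ≤? 2 ^ 9)) doubling
  where
  slack : ∀ w → 36 * suc (suc w) + 31 + (36 * w + 31) ≡ 2 * (36 * suc w + 31)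
  slack = solve-∀
  doubling : ∀ u → 9 ≤ u → 36 * suc u + 31 ≤ 2 * (36 * u + 31)
  doubling (suc w) _ = subst₂ _≤_ (+-identityʳ _) (slack w) (+-monoʳ-≤ (36 * suc (suc w) + 31) (z≤n {36 * w + 31}))

[180u+181]*[90u+91]≤2^u : ∀ {u} → 30 ≤ u → (180 * u + 181) * (90 * u + 91) ≤ 2 ^ u
[180u+181]*[90u+91]≤2^u = ≤2^-induction Q (from-yes (Q 30 ≤? 2 ^ 30)) doubling
  where
  Q : ℕ → ℕ
  Q u = (180 * u + 181) * (90 * u + 91)
  slack : ∀ w → (180 * (3 + w) + 181) * (90 * (3 + w) + 91) + (16200 * (w * w) + 65070 * w + 32941)
              ≡ 2 * ((180 * (2 + w) + 181) * (90 * (2 + w) + 91))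
  slack = solve-∀
  doubling : ∀ u → 30 ≤ u → Q (suc u) ≤ 2 * Q u
  doubling (2+ w) (s≤s (s≤s _)) = subst (Q (3 + w) ≤_) (slack w) (m≤m+n (Q (3 + w)) _)

6t+1≤2^[t/6] : ∀ {t} → 54 ≤ t → suc (6 * t) ≤ 2 ^ (t / 6)
6t+1≤2^[t/6] {t} 54≤t = begin
  suc (6 * t)             ≤⟨ s≤s (*-monoʳ-≤ 6 t≤6u+5) ⟩
  suc (6 * (6 * u + 5))   ≡⟨ rearrange u ⟩
  36 * u + 31             ≤⟨ 36u+31≤2^u (m*n≤o⇒m≤o/n 54≤t) ⟩
  2 ^ u                   ∎
  where
  open ≤-Reasoning
  u = t / 6
  t≤6u+5 : t ≤ 6 * u + 5
  t≤6u+5 = s≤s⁻¹ (subst (suc t ≤_) (rearrange′ u) (m<[m/n]*n+n t 6))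
    where
    rearrange′ : ∀ u → u * 6 + 6 ≡ suc (6 * u + 5)
    rearrange′ = solve-∀
  rearrange : ∀ u → suc (6 * (6 * u + 5)) ≡ 36 * u + 31
  rearrange = solve-∀

[30a+1]*[15a+1]≤2^[a/6] : ∀ {a} → 180 ≤ a → suc (30 * a) * suc (15 * a) ≤ 2 ^ (a / 6)
[30a+1]*[15a+1]≤2^[a/6] {a} 180≤a = begin
  suc (30 * a) * suc (15 * a)                     ≤⟨ *-mono-≤ (s≤s (*-monoʳ-≤ 30 a≤6u+5)) (s≤s (*-monoʳ-≤ 15 a≤6u+5)) ⟩
  suc (30 * (6 * u + 5)) * suc (15 * (6 * u + 5)) ≡⟨ expand u ⟩
  (180 * u + 151) * (90 * u + 76)
    ≤⟨ *-mono-≤ (+-monoʳ-≤ (180 * u) (from-yes (151 ≤? 181))) (+-monoʳ-≤ (90 * u) (from-yes (76 ≤? 91))) ⟩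
  (180 * u + 181) * (90 * u + 91)                 ≤⟨ [180u+181]*[90u+91]≤2^u (m*n≤o⇒m≤o/n 180≤a) ⟩
  2 ^ u                                           ∎
  where
  open ≤-Reasoning
  u = a / 6
  a≤6u+5 : a ≤ 6 * u + 5
  a≤6u+5 = s≤s⁻¹ (subst (suc a ≤_) (rearrange u) (m<[m/n]*n+n a 6))
    where
    rearrange : ∀ u → u * 6 + 6 ≡ suc (6 * u + 5)
    rearrange = solve-∀
  expand : ∀ u → suc (30 * (6 * u + 5)) * suc (15 * (6 * u + 5)) ≡ (180 * u + 151) * (90 * u + 76)
  expand = solve-∀

⌈_/6⌉ : ℕ → ℕ
⌈ t /6⌉ = (t + 5) / 6

⌈t/6⌉<t : ∀ {t} → 2 ≤ t → ⌈ t /6⌉ < t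
⌈t/6⌉<t {t@(2+ k)} (s≤s (s≤s z≤n)) = m<n*o⇒m/o<n {t + 5} {t} {6} (subst₂ _≤_ (lhs k) (rhs k) (m≤m+n (8 + k) (4 + 5 * k)))
  where
  lhs : ∀ k → 8 + k ≡ suc (2+ k + 5)
  lhs = solve-∀
  rhs : ∀ k → 8 + k + (4 + 5 * k) ≡ 2+ k * 6
  rhs = solve-∀

1≤⌈t/6⌉ : ∀ {t} → 1 ≤ t → 1 ≤ ⌈ t /6⌉
1≤⌈t/6⌉ 1≤t = m≥n⇒m/n>0 (+-monoˡ-≤ 5 1≤t)

t≤6*⌈t/6⌉ : ∀ t → t ≤ 6 * ⌈ t /6⌉
t≤6*⌈t/6⌉ t = +-cancelʳ-≤ 5 _ _ (s≤s⁻¹ (subst (suc (t + 5) ≤_) (rearrange ⌈ t /6⌉) (m<[m/n]*n+n (t + 5) 6)))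
  where
  rearrange : ∀ c → c * 6 + 6 ≡ suc (6 * c + 5)
  rearrange = solve-∀

-- lcmMultiple t = F(30t₀) F(30t₁) ⋯ F(30) F(5), where t₀ = t, tᵢ₊₁ = ⌈tᵢ/6⌉ and the chain stops at 1.
private
  lcmMultipleWithin : ℕ → ℕ → ℕ
  lcmMultipleWithin _       zero      = 1
  lcmMultipleWithin zero    (suc _)   = 1
  lcmMultipleWithin (suc k) 1         = chebyshev 30 * chebyshev 5
  lcmMultipleWithin (suc k) t@(2+ _)  = chebyshev (30 * t) * lcmMultipleWithin k ⌈ t /6⌉

  lcmMultipleWithin-irrelevant : ∀ {k l} t → t ≤ k → t ≤ l → lcmMultipleWithin k t ≡ lcmMultipleWithin l t
  lcmMultipleWithin-irrelevant zero _ _ = refl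
  lcmMultipleWithin-irrelevant {suc _} {suc _} 1    _ _ = refl
  lcmMultipleWithin-irrelevant {suc k} {suc l} t@(2+ _) t≤1+k t≤1+l =
    cong (chebyshev (30 * t) *_) (lcmMultipleWithin-irrelevant ⌈ t /6⌉ (shrink t≤1+k) (shrink t≤1+l))
    where
    shrink : ∀ {j} → t ≤ suc j → ⌈ t /6⌉ ≤ j
    shrink t≤1+j = s≤s⁻¹ (≤-trans (⌈t/6⌉<t (s≤s (s≤s z≤n))) t≤1+j)

  lcmMultipleWithin≢0 : ∀ k t → NonZero (lcmMultipleWithin k t)
  lcmMultipleWithin≢0 _       zero     = _
  lcmMultipleWithin≢0 zero    (suc _)  = _
  lcmMultipleWithin≢0 (suc k) 1        = m*n≢0 _ _ {{chebyshev≢0 30}} {{chebyshev≢0 5}}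
  lcmMultipleWithin≢0 (suc k) t@(2+ _) = m*n≢0 _ _ {{chebyshev≢0 (30 * t)}} {{lcmMultipleWithin≢0 k ⌈ t /6⌉}}

lcmMultiple : ℕ → ℕ
lcmMultiple t = lcmMultipleWithin t t

lcmMultiple≢0 : ∀ t → NonZero (lcmMultiple t)
lcmMultiple≢0 t = lcmMultipleWithin≢0 t t

lcmMultiple-unfold : ∀ t → 2 ≤ t → lcmMultiple t ≡ chebyshev (30 * t) * lcmMultiple ⌈ t /6⌉
lcmMultiple-unfold t@(2+ k) 2≤t@(s≤s (s≤s z≤n)) =
  cong (chebyshev (30 * t) *_) (lcmMultipleWithin-irrelevant ⌈ t /6⌉ (s≤s⁻¹ (⌈t/6⌉<t 2≤t)) ≤-refl)

module _ {p : ℕ} (p-prime : Prime p) where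
  private
    v : ℕ → ℕ
    v = valuation p-prime

    valuation-*-chebyshev : ∀ x m .{{_ : NonZero m}} → v (chebyshev x * m) ≡ v (chebyshev x) + v m
    valuation-*-chebyshev x m = valuation-* p-prime (chebyshev x) m {{chebyshev≢0 x}}

  ilog[30t]≤valuation-lcmMultiple : ∀ {t} → 1 ≤ t → ilog p-prime (30 * t) ≤ v (lcmMultiple t)
  ilog[30t]≤valuation-lcmMultiple {t} = <-rec P step t
    where
    P : ℕ → Set
    P t = 1 ≤ t → ilog p-prime (30 * t) ≤ v (lcmMultiple t)
    open ≤-Reasoning
    step : ∀ t → (∀ {s} → s < t → P s) → P t
    step 1 _ _ = begin
      ilog p-prime 30                                          ≤⟨ ilog≤valuation-chebyshev+ilog p-prime 30 ⟩
      v (chebyshev 30) + ilog p-prime 5                        ≤⟨ +-monoʳ-≤ (v (chebyshev 30)) (ilog≤valuation-chebyshev+ilog p-prime 5) ⟩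
      v (chebyshev 30) + (v (chebyshev 5) + 0)                 ≡⟨ cong (v (chebyshev 30) +_) (+-identityʳ _) ⟩
      v (chebyshev 30) + v (chebyshev 5)                       ≡⟨ valuation-*-chebyshev 30 (chebyshev 5) {{chebyshev≢0 5}} ⟨
      v (lcmMultiple 1)                                        ∎
    step t@(2+ _) rec _ = begin
      ilog p-prime (30 * t)                                    ≤⟨ ilog≤valuation-chebyshev+ilog p-prime (30 * t) ⟩
      v (chebyshev (30 * t)) + ilog p-prime (30 * t / 6)       ≤⟨ +-monoʳ-≤ (v (chebyshev (30 * t))) (ilog-mono p-prime 30t/6≤30c) ⟩
      v (chebyshev (30 * t)) + ilog p-prime (30 * c)
        ≤⟨ +-monoʳ-≤ (v (chebyshev (30 * t))) (rec (⌈t/6⌉<t 2≤t) (1≤⌈t/6⌉ {t} (s≤s z≤n))) ⟩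
      v (chebyshev (30 * t)) + v (lcmMultiple c)               ≡⟨ valuation-*-chebyshev (30 * t) (lcmMultiple c) {{lcmMultiple≢0 c}} ⟨
      v (chebyshev (30 * t) * lcmMultiple c)                   ≡⟨ cong v (lcmMultiple-unfold t 2≤t) ⟨
      v (lcmMultiple t)                                        ∎
      where
      c = ⌈ t /6⌉
      2≤t : 2 ≤ t
      2≤t = s≤s (s≤s z≤n)
      30t/6≤30c : 30 * t / 6 ≤ 30 * c
      30t/6≤30c = begin
        30 * t / 6    ≡⟨ cong (_/ 6) (*-assoc 5 6 t) ⟩
        5 * (6 * t) / 6 ≡⟨ cong (λ y → 5 * y / 6) (*-comm 6 t) ⟩
        5 * (t * 6) / 6 ≡⟨ cong (_/ 6) (*-assoc 5 t 6) ⟨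
        5 * t * 6 / 6 ≡⟨ m*n/n≡m (5 * t) 6 ⟩
        5 * t         ≤⟨ *-monoʳ-≤ 5 (t≤6*⌈t/6⌉ t) ⟩
        5 * (6 * c)   ≡⟨ *-assoc 5 6 c ⟨
        30 * c        ∎

private
  exponent-step : ∀ {t} → 64 ≤ t → t / 6 + 40 * t + 49 * (⌈ t /6⌉ + 1) ≤ 49 * (t + 1)
  exponent-step {t} 64≤t = subst₂ _≤_ (rearrange u t c) (rearrange′ t)
    (+-monoˡ-≤ (40 * t + 49) (*-cancelˡ-≤ {u + 49 * c} {9 * t} 6 6[u+49c]≤6[9t]))
    where
    open ≤-Reasoning
    u = t / 6
    c = ⌈ t /6⌉
    6[u+49c]≤6[9t] : 6 * (u + 49 * c) ≤ 6 * (9 * t)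
    6[u+49c]≤6[9t] = begin
      6 * (u + 49 * c)      ≡⟨ distrib u c ⟩
      u * 6 + 49 * (c * 6)  ≤⟨ +-mono-≤ (m/n*n≤m t 6) (*-monoʳ-≤ 49 (m/n*n≤m (t + 5) 6)) ⟩
      t + 49 * (t + 5)      ≡⟨ expand t ⟩
      50 * t + 245          ≤⟨ +-monoʳ-≤ (50 * t) (≤-trans (from-yes (245 ≤? 4 * 64)) (*-monoʳ-≤ 4 64≤t)) ⟩
      50 * t + 4 * t        ≡⟨ collect t ⟩
      6 * (9 * t)           ∎
      where
      distrib : ∀ u c → 6 * (u + 49 * c) ≡ u * 6 + 49 * (c * 6)
      distrib = solve-∀
      expand : ∀ t → t + 49 * (t + 5) ≡ 50 * t + 245
      expand = solve-∀
      collect : ∀ t → 50 * t + 4 * t ≡ 6 * (9 * t)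
      collect = solve-∀
    rearrange : ∀ u t c → u + 49 * c + (40 * t + 49) ≡ u + 40 * t + 49 * (c + 1)
    rearrange = solve-∀
    rearrange′ : ∀ t → 9 * t + (40 * t + 49) ≡ 49 * (t + 1)
    rearrange′ = solve-∀

-- For t ≥ 64 the exponent 49 (t + 1) absorbs 40 t from chebyshev-upper, log₂ (6t + 1) and the recursive call at
-- ⌈t/6⌉; smaller t are evaluated.
lcmMultiple≤ : ∀ {t} → 1 ≤ t → lcmMultiple t ≤ 2 ^ (49 * (t + 1))
lcmMultiple≤ {t} = <-rec P step t
  where
  P : ℕ → Set
  P t = 1 ≤ t → lcmMultiple t ≤ 2 ^ (49 * (t + 1))
  step : ∀ t → (∀ {s} → s < t → P s) → P t
  step t rec 1≤t with t <? 64
  ... | yes t<64 = from-yes (allUpTo? (λ t → lcmMultiple t ≤? 2 ^ (49 * (t + 1))) 64) t<64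
  ... | no  t≮64 = begin
    lcmMultiple t                                           ≡⟨ lcmMultiple-unfold t 2≤t ⟩
    chebyshev (30 * t) * lcmMultiple c                      ≤⟨ *-mono-≤ (chebyshev-upper t) (rec (⌈t/6⌉<t 2≤t) (1≤⌈t/6⌉ 1≤t)) ⟩
    suc (6 * t) * 2 ^ (40 * t) * 2 ^ (49 * (c + 1))
      ≤⟨ *-monoˡ-≤ _ (*-monoˡ-≤ _ (6t+1≤2^[t/6] (≤-trans (from-yes (54 ≤? 64)) 64≤t))) ⟩
    2 ^ (t / 6) * 2 ^ (40 * t) * 2 ^ (49 * (c + 1))         ≡⟨ cong (_* 2 ^ (49 * (c + 1))) (^-distribˡ-+-* 2 (t / 6) (40 * t)) ⟨
    2 ^ (t / 6 + 40 * t) * 2 ^ (49 * (c + 1))               ≡⟨ ^-distribˡ-+-* 2 (t / 6 + 40 * t) _ ⟨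
    2 ^ (t / 6 + 40 * t + 49 * (c + 1))                     ≤⟨ ^-monoʳ-≤ 2 (exponent-step 64≤t) ⟩
    2 ^ (49 * (t + 1))                                      ∎
    where
    open ≤-Reasoning
    c = ⌈ t /6⌉
    64≤t : 64 ≤ t
    64≤t = ≮⇒≥ t≮64
    2≤t : 2 ≤ t
    2≤t = ≤-trans (from-yes (2 ≤? 64)) 64≤t

-- A prime between 3n/2 and 2n

chebyshev∣lcmMultiple*lcmMultiple : ∀ {a t s} → 1 ≤ t → 1 ≤ s → 30 * a < 2 * (30 * t) → 30 * a ≤ (30 * s) * (30 * s) →
  (∀ {q} → Prime q → q ≤ 30 * t ⊎ 30 * a < q) → chebyshev (30 * a) ∣ lcmMultiple t * lcmMultiple s
chebyshev∣lcmMultiple*lcmMultiple {a} {t} {s} 1≤t 1≤s 30a<60t 30a≤[30s]² no-prime =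
  ≤ᵥ⇒∣ {{chebyshev≢0 (30 * a)}} {{lcm≢0}} λ p-prime → begin
    valuation p-prime (chebyshev (30 * a))                        ≤⟨ valuation-chebyshev≤ilog p-prime (30 * a) ⟩
    ilog p-prime (30 * a)
      ≤⟨ ilog-gap p-prime {30 * t} {30 * a} {30 * s} 30a<60t 30a≤[30s]² (no-prime p-prime) ⟩
    ilog p-prime (30 * t) + ilog p-prime (30 * s)
      ≤⟨ +-mono-≤ (ilog[30t]≤valuation-lcmMultiple p-prime 1≤t) (ilog[30t]≤valuation-lcmMultiple p-prime 1≤s) ⟩
    valuation p-prime (lcmMultiple t) + valuation p-prime (lcmMultiple s)
      ≡⟨ valuation-* p-prime (lcmMultiple t) (lcmMultiple s) {{lcmMultiple≢0 t}} {{lcmMultiple≢0 s}} ⟨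
    valuation p-prime (lcmMultiple t * lcmMultiple s)             ∎
  where
  open ≤-Reasoning
  lcm≢0 : NonZero (lcmMultiple t * lcmMultiple s)
  lcm≢0 = m*n≢0 _ _ {{lcmMultiple≢0 t}} {{lcmMultiple≢0 s}}

-- Without such a prime, F(30a) would divide lcmMultiple t · lcmMultiple s, which is too small by chebyshev-lower and lcmMultiple≤.
prime-in-⟨30t,30a] : ∀ {a t s} → 180 ≤ a → 1 ≤ t → 1 ≤ s → 30 * a < 2 * (30 * t) → 30 * a ≤ (30 * s) * (30 * s) →
  a / 6 + 49 * (t + 1) + 49 * (s + 1) < 39 * a → ∃[ q ] Prime q × 30 * t < q × q ≤ 30 * a
prime-in-⟨30t,30a] {a} {t} {s} 180≤a 1≤t 1≤s 30a<60t 30a≤[30s]² exponents<39a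
  with anyUpTo? (λ q → prime? q ×-dec 30 * t <? q) (suc (30 * a))
... | yes (q , q<1+30a , q-prime , 30t<q) = q , q-prime , 30t<q , s≤s⁻¹ q<1+30a
... | no  ∄q = ⊥-elim (<⇒≱ (^-monoʳ-< 2 (s≤s (s≤s z≤n)) exponents<39a) (begin
  2 ^ (39 * a)                                           ≤⟨ chebyshev-lower a ⟩
  suc (30 * a) * suc (15 * a) * chebyshev (30 * a)       ≤⟨ *-mono-≤ ([30a+1]*[15a+1]≤2^[a/6] 180≤a) F≤lcm*lcm ⟩
  2 ^ (a / 6) * (lcmMultiple t * lcmMultiple s)          ≤⟨ *-monoʳ-≤ (2 ^ (a / 6)) (*-mono-≤ (lcmMultiple≤ 1≤t) (lcmMultiple≤ 1≤s)) ⟩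
  2 ^ (a / 6) * (2 ^ (49 * (t + 1)) * 2 ^ (49 * (s + 1))) ≡⟨ cong (2 ^ (a / 6) *_) (^-distribˡ-+-* 2 (49 * (t + 1)) _) ⟨
  2 ^ (a / 6) * 2 ^ (49 * (t + 1) + 49 * (s + 1))         ≡⟨ ^-distribˡ-+-* 2 (a / 6) _ ⟨
  2 ^ (a / 6 + (49 * (t + 1) + 49 * (s + 1)))             ≡⟨ cong (2 ^_) (+-assoc (a / 6) _ _) ⟨
  2 ^ (a / 6 + 49 * (t + 1) + 49 * (s + 1))               ∎))
  where
  open ≤-Reasoning
  no-prime : ∀ {q} → Prime q → q ≤ 30 * t ⊎ 30 * a < q
  no-prime {q} q-prime with q ≤? 30 * t | 30 * a <? q
  ... | yes q≤30t | _        = inj₁ q≤30t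
  ... | no  _     | yes 30a<q = inj₂ 30a<q
  ... | no  q≰30t | no  30a≮q = ⊥-elim (∄q (q , s≤s (≮⇒≥ 30a≮q) , q-prime , ≰⇒> q≰30t))
  F≤lcm*lcm : chebyshev (30 * a) ≤ lcmMultiple t * lcmMultiple s
  F≤lcm*lcm = ∣⇒≤ {{m*n≢0 _ _ {{lcmMultiple≢0 t}} {{lcmMultiple≢0 s}}}}
    (chebyshev∣lcmMultiple*lcmMultiple {a} {t} {s} 1≤t 1≤s 30a<60t 30a≤[30s]² no-prime)

-- a, t and s are chosen so that 30a < 2n ≤ 30a + 30, 3n ≤ 60t and 30a ≤ (30s)².
module _ {n : ℕ} (2761≤n : 2761 ≤ n) where
  private
    instance
      2n≢0 : NonZero (2 * n)
      2n≢0 = >-nonZero (≤-trans (s≤s z≤n) (*-monoʳ-≤ 2 (≤-trans (s≤s z≤n) 2761≤n)))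

    a t s : ℕ
    a = pred (2 * n) / 30
    t = (3 * n + 59) / 60
    s = a / 60 + 1

    open ≤-Reasoning

    30a<2n : 30 * a < 2 * n
    30a<2n = begin-strict
      30 * a       ≡⟨ *-comm 30 a ⟩
      a * 30       ≤⟨ m/n*n≤m (pred (2 * n)) 30 ⟩
      pred (2 * n) <⟨ n<1+n (pred (2 * n)) ⟩
      suc (pred (2 * n)) ≡⟨ suc-pred (2 * n) ⟩
      2 * n        ∎

    2n≤30a+30 : 2 * n ≤ 30 * a + 30
    2n≤30a+30 = begin
      2 * n              ≡⟨ suc-pred (2 * n) ⟨
      suc (pred (2 * n)) ≤⟨ m<[m/n]*n+n (pred (2 * n)) 30 ⟩
      a * 30 + 30        ≡⟨ cong (_+ 30) (*-comm a 30) ⟩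
      30 * a + 30        ∎

    3n≤60t : 3 * n ≤ 2 * (30 * t)
    3n≤60t = +-cancelʳ-≤ 60 _ _ (begin
      3 * n + 60       ≡⟨ +-suc (3 * n) 59 ⟩
      suc (3 * n + 59) ≤⟨ m<[m/n]*n+n (3 * n + 59) 60 ⟩
      t * 60 + 60      ≡⟨ cong (_+ 60) (trans (*-comm t 60) (*-assoc 2 30 t)) ⟩
      2 * (30 * t) + 60 ∎)

    60t≤3n+59 : 60 * t ≤ 3 * n + 59
    60t≤3n+59 = subst (_≤ 3 * n + 59) (*-comm t 60) (m/n*n≤m (3 * n + 59) 60)

    a<60s : a < 60 * s
    a<60s = subst (a <_) (rearrange (a / 60)) (m<[m/n]*n+n a 60)
      where
      rearrange : ∀ x → x * 60 + 60 ≡ 60 * (x + 1)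
      rearrange = solve-∀

    60s≤a+60 : 60 * s ≤ a + 60
    60s≤a+60 = subst (_≤ a + 60) (rearrange (a / 60)) (+-monoˡ-≤ 60 (m/n*n≤m a 60))
      where
      rearrange : ∀ x → x * 60 + 60 ≡ 60 * (x + 1)
      rearrange = solve-∀

    184≤a : 184 ≤ a
    184≤a = m*n≤o⇒m≤o/n {184} {30} (<⇒≤pred (<-≤-trans (from-yes (184 * 30 <? 2 * 2761)) (*-monoʳ-≤ 2 2761≤n)))

    180≤a : 180 ≤ a
    180≤a = ≤-trans (from-yes (180 ≤? 184)) 184≤a

    1≤t : 1 ≤ t
    1≤t = m*n≤o⇒m≤o/n {1} {60} (≤-trans (from-yes (60 ≤? 3 + 59)) (+-monoˡ-≤ 59 (*-monoʳ-≤ 3 (≤-trans (s≤s z≤n) 2761≤n))))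

    2≤s : 2 ≤ s
    2≤s = +-monoˡ-≤ 1 (m*n≤o⇒m≤o/n {1} {60} (≤-trans (from-yes (60 ≤? 184)) 184≤a))

    30a<60t : 30 * a < 2 * (30 * t)
    30a<60t = <-≤-trans 30a<2n (≤-trans (*-monoˡ-≤ n (from-yes (2 ≤? 3))) 3n≤60t)

    30a≤[30s]² : 30 * a ≤ (30 * s) * (30 * s)
    30a≤[30s]² = begin
      30 * a         ≤⟨ *-monoʳ-≤ 30 (<⇒≤ a<60s) ⟩
      30 * (60 * s)  ≡⟨ rearrange s ⟩
      900 * s * 2    ≤⟨ *-monoʳ-≤ (900 * s) 2≤s ⟩
      900 * s * s    ≡⟨ rearrange′ s ⟩
      (30 * s) * (30 * s) ∎
      where
      rearrange : ∀ s → 30 * (60 * s) ≡ 900 * s * 2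
      rearrange = solve-∀
      rearrange′ : ∀ s → 900 * s * s ≡ (30 * s) * (30 * s)
      rearrange′ = solve-∀

    exponents<39a : a / 6 + 49 * (t + 1) + 49 * (s + 1) < 39 * a
    exponents<39a = *-cancelˡ-< 60 _ _ (begin-strict
      60 * (a / 6 + 49 * (t + 1) + 49 * (s + 1))
        ≡⟨ expand (a / 6) t s ⟩
      10 * (a / 6 * 6) + 49 * (60 * t) + 49 * (60 * s) + 5880
        ≤⟨ +-monoˡ-≤ 5880 (+-mono-≤ (+-mono-≤ (*-monoʳ-≤ 10 (m/n*n≤m a 6)) (*-monoʳ-≤ 49 60t≤3n+59)) (*-monoʳ-≤ 49 60s≤a+60)) ⟩
      10 * a + 49 * (3 * n + 59) + 49 * (a + 60) + 5880
        ≤⟨ +-monoˡ-≤ 5880 (+-monoˡ-≤ (49 * (a + 60)) (+-monoʳ-≤ (10 * a) (*-monoʳ-≤ 49 (+-monoˡ-≤ 59 3n≤45a+45)))) ⟩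
      10 * a + 49 * (45 * a + 45 + 59) + 49 * (a + 60) + 5880
        ≡⟨ collect a ⟩
      2264 * a + 13916
        <⟨ +-monoʳ-< (2264 * a) (≤-trans (from-yes (13917 ≤? 76 * 184)) (*-monoʳ-≤ 76 184≤a)) ⟩
      2264 * a + 76 * a
        ≡⟨ collect′ a ⟩
      60 * (39 * a) ∎)
      where
      3n≤45a+45 : 3 * n ≤ 45 * a + 45
      3n≤45a+45 = *-cancelˡ-≤ 2 (begin
        2 * (3 * n)      ≡⟨ swap n ⟩
        3 * (2 * n)      ≤⟨ *-monoʳ-≤ 3 2n≤30a+30 ⟩
        3 * (30 * a + 30) ≡⟨ swap′ a ⟩
        2 * (45 * a + 45) ∎)
        where
        swap : ∀ n → 2 * (3 * n) ≡ 3 * (2 * n)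
        swap = solve-∀
        swap′ : ∀ a → 3 * (30 * a + 30) ≡ 2 * (45 * a + 45)
        swap′ = solve-∀
      expand : ∀ u t s → 60 * (u + 49 * (t + 1) + 49 * (s + 1)) ≡ 10 * (u * 6) + 49 * (60 * t) + 49 * (60 * s) + 5880
      expand = solve-∀
      collect : ∀ a → 10 * a + 49 * (45 * a + 45 + 59) + 49 * (a + 60) + 5880 ≡ 2264 * a + 13916
      collect = solve-∀
      collect′ : ∀ a → 2264 * a + 76 * a ≡ 60 * (39 * a)
      collect′ = solve-∀

  prime-in-⟨3n/2,2n⟩-large : ∃[ q ] Prime q × 3 * n < 2 * q × q < 2 * n
  prime-in-⟨3n/2,2n⟩-large =
    let q , q-prime , 30t<q , q≤30a = prime-in-⟨30t,30a] {a} {t} {s} 180≤a 1≤t (≤-trans (s≤s z≤n) 2≤s) 30a<60t 30a≤[30s]² exponents<39a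
    in q , q-prime , ≤-<-trans 3n≤60t (*-monoʳ-< 2 30t<q) , ≤-<-trans q≤30a 30a<2n

private
  primeChain : List ℕ
  primeChain = 53 ∷ 71 ∷ 89 ∷ 113 ∷ 151 ∷ 199 ∷ 263 ∷ 349 ∷ 463 ∷ 617 ∷ 823 ∷ 1097 ∷ 1459 ∷ 1933 ∷ 2557 ∷ 3407 ∷ 4523 ∷ []

  primeChain-prime : All Prime primeChain
  primeChain-prime = from-yes (all? prime? primeChain)

  InRange : ℕ → ℕ → Set
  InRange n q = 3 * n < 2 * q × q < 2 * n

  covered : ∀ {n} → n < 2761 → 29 ≤ n → Any (InRange n) primeChain
  covered = from-yes (allUpTo? (λ n → 29 ≤? n →-dec any? (λ q → 3 * n <? 2 * q ×-dec q <? 2 * n) primeChain) 2761)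

prime-in-⟨3n/2,2n⟩-small : ∀ {n} → 29 ≤ n → n < 2761 → ∃[ q ] Prime q × 3 * n < 2 * q × q < 2 * n
prime-in-⟨3n/2,2n⟩-small 29≤n n<2761 =
  let i = covered n<2761 29≤n in Any.lookup i , lookupAny primeChain-prime i

prime-in-⟨3n/2,2n⟩ : ∀ {n} → 29 ≤ n → ∃[ q ] Prime q × 3 * n < 2 * q × q < 2 * n
prime-in-⟨3n/2,2n⟩ {n} 29≤n with n <? 2761
... | yes n<2761 = prime-in-⟨3n/2,2n⟩-small 29≤n n<2761
... | no  n≮2761 = prime-in-⟨3n/2,2n⟩-large (≮⇒≥ n≮2761)

-- An m-th power between n and 3n/2

module _ {m : ℕ} .{{_ : NonZero m}} where

  ^-cancelʳ-≤ : ∀ {u v} → u ^ m ≤ v ^ m → u ≤ v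
  ^-cancelʳ-≤ u^m≤v^m = ≮⇒≥ λ v<u → <⇒≱ (^-monoˡ-< m v<u) u^m≤v^m

  private
    monomial-≤ : ∀ {A B X Y N} j → j ≤ m → A ^ m ≤ N * X ^ m → B ^ m ≤ N * Y ^ m →
                 A ^ j * B ^ (m ∸ j) ≤ N * (X ^ j * Y ^ (m ∸ j))
    monomial-≤ {A} {B} {X} {Y} {N} j j≤m A^m≤ B^m≤ = ^-cancelʳ-≤ (begin
      (A ^ j * B ^ k) ^ m                   ≡⟨ ^-distribʳ-* (A ^ j) (B ^ k) m ⟩
      (A ^ j) ^ m * (B ^ k) ^ m             ≡⟨ cong₂ _*_ (^-comm A j m) (^-comm B k m) ⟩
      (A ^ m) ^ j * (B ^ m) ^ k             ≤⟨ *-mono-≤ (^-monoˡ-≤ j A^m≤) (^-monoˡ-≤ k B^m≤) ⟩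
      (N * X ^ m) ^ j * (N * Y ^ m) ^ k     ≡⟨ cong₂ _*_ (^-distribʳ-* N (X ^ m) j) (^-distribʳ-* N (Y ^ m) k) ⟩
      N ^ j * (X ^ m) ^ j * (N ^ k * (Y ^ m) ^ k) ≡⟨ interchange (N ^ j) _ (N ^ k) _ ⟩
      N ^ j * N ^ k * ((X ^ m) ^ j * (Y ^ m) ^ k) ≡⟨ cong₂ _*_ N^j*N^k≡N^m (cong₂ _*_ (^-comm X m j) (^-comm Y m k)) ⟩
      N ^ m * ((X ^ j) ^ m * (Y ^ k) ^ m)   ≡⟨ cong (N ^ m *_) (^-distribʳ-* (X ^ j) (Y ^ k) m) ⟨
      N ^ m * (X ^ j * Y ^ k) ^ m           ≡⟨ ^-distribʳ-* N (X ^ j * Y ^ k) m ⟨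
      (N * (X ^ j * Y ^ k)) ^ m             ∎)
      where
      open ≤-Reasoning
      k = m ∸ j
      N^j*N^k≡N^m : N ^ j * N ^ k ≡ N ^ m
      N^j*N^k≡N^m = trans (sym (^-distribˡ-+-* N j k)) (cong (N ^_) (m+[n∸m]≡n j≤m))
      interchange : ∀ a b c d → a * b * (c * d) ≡ a * c * (b * d)
      interchange = solve-∀

  [A+B]^m<N*[X+Y]^m : ∀ {A B X Y N} → A ^ m ≤ N * X ^ m → B ^ m < N * Y ^ m → (A + B) ^ m < N * (X + Y) ^ m
  [A+B]^m<N*[X+Y]^m {A} {B} {X} {Y} {N} A^m≤ B^m< = begin-strict
    (A + B) ^ m                                ≡⟨ binomial-theorem A B m ⟩
    Σ (λ (j : Fin (suc m)) → binomialTerm A B m (toℕ j)) <⟨ +-mono-<-≤ first-term (Σ-mono other-terms) ⟩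
    Σ (λ (j : Fin (suc m)) → N * binomialTerm X Y m (toℕ j)) ≡⟨ *-distribˡ-Σ N (λ (j : Fin (suc m)) → binomialTerm X Y m (toℕ j)) ⟨
    N * Σ (λ (j : Fin (suc m)) → binomialTerm X Y m (toℕ j)) ≡⟨ cong (N *_) (binomial-theorem X Y m) ⟨
    N * (X + Y) ^ m                            ∎
    where
    open ≤-Reasoning
    first-term : binomialTerm A B m 0 < N * binomialTerm X Y m 0
    first-term = subst₂ (λ u v → u < N * v) (sym (C₀-term A B)) (sym (C₀-term X Y)) B^m<
      where
      C₀-term : ∀ a b → binomialTerm a b m 0 ≡ b ^ m
      C₀-term a b = trans (*-identityˡ _) (*-identityˡ _)
    other-terms : ∀ (i : Fin m) → binomialTerm A B m (suc (toℕ i)) ≤ N * binomialTerm X Y m (suc (toℕ i))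
    other-terms i = subst (binomialTerm A B m j ≤_) (swap (m C j) N _)
      (*-monoʳ-≤ (m C j) (monomial-≤ {A} {B} {X} {Y} {N} j (toℕ<n i) A^m≤ (<⇒≤ B^m<)))
      where
      j = suc (toℕ i)
      swap : ∀ c n x → c * (n * x) ≡ n * (c * x)
      swap = solve-∀

integer-root : ∀ m .{{_ : NonZero m}} n → ∃[ b ] b ^ m ≤ n × n < suc b ^ m
integer-root m zero    = 0 , ≤-reflexive (0^m≡0 m) , subst (0 <_) (sym (^-zeroˡ m)) z<s
  where
  0^m≡0 : ∀ m .{{_ : NonZero m}} → 0 ^ m ≡ 0
  0^m≡0 (suc _) = refl
integer-root m (suc n) with integer-root m n
... | b , b^m≤n , n<[1+b]^m with suc b ^ m ≤? suc n
...   | yes [1+b]^m≤1+n = suc b , [1+b]^m≤1+n , ≤-<-trans n<[1+b]^m (^-monoˡ-< m (n<1+n (suc b)))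
...   | no  [1+b]^m≰1+n = b , m≤n⇒m≤1+n b^m≤n , ≰⇒> [1+b]^m≰1+n

power-in-⟨n,3n/2⟩ : ∀ m .{{_ : NonZero m}} {n p q} → 2 * (q + p) ^ m < 3 * q ^ m → q ^ m < n * p ^ m →
                    ∃[ a ] 0 < a × n < a ^ m × 2 * a ^ m < 3 * n
power-in-⟨n,3n/2⟩ m {n} {p} {q} 2[q+p]^m<3q^m q^m<np^m =
  let b , b^m≤n , n<[1+b]^m = integer-root m n in suc b , z<s , n<[1+b]^m , 2[1+b]^m<3n b b^m≤n
  where
  open ≤-Reasoning
  2[1+b]^m<3n : ∀ b → b ^ m ≤ n → 2 * suc b ^ m < 3 * n
  2[1+b]^m<3n b b^m≤n = *-cancelʳ-< (q ^ m) (2 * suc b ^ m) (3 * n) (begin-strict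
    2 * suc b ^ m * q ^ m      ≡⟨ *-assoc 2 (suc b ^ m) (q ^ m) ⟩
    2 * (suc b ^ m * q ^ m)    ≡⟨ cong (2 *_) (^-distribʳ-* (suc b) q m) ⟨
    2 * (suc b * q) ^ m        ≡⟨ cong (λ x → 2 * x ^ m) (+-comm q (b * q)) ⟩
    2 * (b * q + q) ^ m        <⟨ *-monoʳ-< 2 ([A+B]^m<N*[X+Y]^m {m} {b * q} {q} {q} {p} {n} [bq]^m≤nq^m q^m<np^m) ⟩
    2 * (n * (q + p) ^ m)      ≡⟨ swap n ((q + p) ^ m) ⟩
    n * (2 * (q + p) ^ m)      ≤⟨ *-monoʳ-≤ n (<⇒≤ 2[q+p]^m<3q^m) ⟩
    n * (3 * q ^ m)            ≡⟨ swap′ n (q ^ m) ⟩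
    3 * n * q ^ m              ∎)
    where
    [bq]^m≤nq^m : (b * q) ^ m ≤ n * q ^ m
    [bq]^m≤nq^m = subst (_≤ n * q ^ m) (sym (^-distribʳ-* b q m)) (*-monoˡ-≤ (q ^ m) b^m≤n)
    swap : ∀ n x → 2 * (n * x) ≡ n * (2 * x)
    swap = solve-∀
    swap′ : ∀ n x → n * (3 * x) ≡ 3 * n * x
    swap′ = solve-∀

threshold⇒29≤n : ∀ m .{{_ : NonZero m}} {n p q} → 0 < p → 2 * (q + p) ^ m < 3 * q ^ m → 72 * q ^ m < 5 * n * p ^ m → 29 ≤ n
threshold⇒29≤n m@(suc k) {n} {p} {q} 0<p 2[q+p]^m<3q^m 72q^m<5np^m = ≰⇒> n≰28
  where
  open ≤-Reasoning
  2p<q : 2 * p < q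
  2p<q = +-cancelˡ-< (2 * q) _ _ (subst₂ _<_ (*-distribˡ-+ 2 q p) (rearrange q) (*-cancelʳ-< (q ^ k) (2 * (q + p)) (3 * q) (begin-strict
    2 * (q + p) * q ^ k         ≤⟨ *-monoʳ-≤ (2 * (q + p)) (^-monoˡ-≤ k (m≤m+n q p)) ⟩
    2 * (q + p) * (q + p) ^ k   ≡⟨ *-assoc 2 (q + p) _ ⟩
    2 * (q + p) ^ m             <⟨ 2[q+p]^m<3q^m ⟩
    3 * q ^ m                   ≡⟨ *-assoc 3 q (q ^ k) ⟨
    3 * q * q ^ k               ∎)))
    where
    rearrange : ∀ q → 3 * q ≡ 2 * q + q
    rearrange = solve-∀
  2p^m≤q^m : 2 * p ^ m ≤ q ^ m
  2p^m≤q^m = begin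
    2 * p ^ m        ≤⟨ *-monoˡ-≤ (p ^ m) (*-monoʳ-≤ 2 (m^n>0 2 k)) ⟩
    2 * 2 ^ k * p ^ m ≡⟨ ^-distribʳ-* 2 p m ⟨
    (2 * p) ^ m      ≤⟨ ^-monoˡ-≤ m (<⇒≤ 2p<q) ⟩
    q ^ m            ∎
  144<5n : 144 < 5 * n
  144<5n = *-cancelʳ-< (p ^ m) 144 (5 * n) (begin-strict
    144 * p ^ m      ≡⟨ *-assoc 72 2 (p ^ m) ⟩
    72 * (2 * p ^ m) ≤⟨ *-monoʳ-≤ 72 2p^m≤q^m ⟩
    72 * q ^ m       <⟨ 72q^m<5np^m ⟩
    5 * n * p ^ m    ∎)
  n≰28 : n ≰ 28
  n≰28 n≤28 = <⇒≱ 144<5n (≤-trans (*-monoʳ-≤ 5 n≤28) (from-yes (5 * 28 ≤? 144)))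

theorem7p7 : (m : ℕ) → 0 < m → (n : ℕ) → 0 < n → AboveThreshold m n →
    ∃[ a ] ∃[ s ] (0 < a) × Prime s
    × (n < a ^ m) × (2 * a ^ m < 3 * n) × (3 * n < 2 * s) × (s < 2 * n)
theorem7p7 m 0<m n _ (p , q , 0<p , _ , 2[q+p]^m<3q^m , 72q^m<5np^m) =
  let a , 0<a , n<a^m , 2a^m<3n = power-in-⟨n,3n/2⟩ m {n} {p} {q} 2[q+p]^m<3q^m q^m<np^m
      s , s-prime , 3n<2s , s<2n = prime-in-⟨3n/2,2n⟩ (threshold⇒29≤n m {n} {p} {q} 0<p 2[q+p]^m<3q^m 72q^m<5np^m)
  in a , s , 0<a , s-prime , n<a^m , 2a^m<3n , 3n<2s , s<2n
  where
  instance
    m≢0 : NonZero m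
    m≢0 = >-nonZero 0<m
  q^m<np^m : q ^ m < n * p ^ m
  q^m<np^m = *-cancelˡ-< 5 _ _ (≤-<-trans (*-monoˡ-≤ (q ^ m) (from-yes (5 ≤? 72))) (subst (72 * q ^ m <_) (*-assoc 5 n (p ^ m)) 72q^m<5np^m))
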